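{- Let $n\ge 4$ be an integer and let $K_n$ be the complete graph on vertex set $\{1,\dots,n\}$. Then, with $o(1)$ denoting a quantity tending to $0$ as $n\to\infty$: \begin{itemize} \item if $n$ is even, then $\frac{1}{12}n^2-\frac{1}{6}n \le \gamma(F_3(K_n)) \le (1+o(1))\left(\frac{1}{12}n^2-\frac{1}{6}n\right)$; \item if $n$ is odd, then $\frac{1}{12}n^2-\frac{1}{6}n+\frac14 \le \gamma(F_3(K_n)) \le (1+o(1))\left(\frac{1}{12}n^2-\frac{1}{6}n+\frac14\right)$; \item if $n\equiv 2$ or $6 \pmod{12}$, then $\gamma(F_3(K_n)) = \frac{1}{12}n^2-\frac{1}{6}n$. \end{itemize}
   Context: For a simple graph $G$ and an integer $k$ with $1 \le k \le |V(G)|-1$, the $k$-token graph $F_k(G)$ is the graph whose vertices are the $k$-element subsets of $V(G)$, two of them being adjacent if and only if their symmetric difference is a pair $\{u,v\}$ with $uv$ an edge of $G$. (Thus $F_3(K_n)$ is the Johnson graph $J(n,3)$: $3$-subsets of $\{1,\dots,n\}$, adjacent when they share exactly $2$ elements.) A dominating set of a graph $H$ is a set $D\subseteq V(H)$ such that every vertex of $H$ is in $D$ or has a neighbor in $D$; the domination number $\gamma(H)$ is the minimum size of a dominating set. -}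

module Defs where

open import Data.Nat using (ℕ; _≤_)
open import Data.Fin using (Fin)
open import Data.Fin.Subset using (Subset; ∣_∣; _∪_; _─_; ⁅_⁆)
open import Data.List using (List; length)
open import Data.List.Membership.Propositional using (_∈_)
open import Data.List.Relation.Unary.All using (All)
open import Data.List.Relation.Unary.Unique.Propositional using (Unique)
open import Data.Product using (Σ; ∃; ∃-syntax; _×_)
open import Data.Sum using (_⊎_)
open import Relation.Binary.PropositionalEquality using (_≡_; _≢_)

Graph : ℕ → Set₁
Graph n = Fin n → Fin n → Set

K : (n : ℕ) → Graph n
K n u v = u ≢ v

_△_ : ∀ {n} → Subset n → Subset n → Subset n
A △ B = (A ─ B) ∪ (B ─ A)

-- Vertices of the k-token graph F_k(G): k-element subsets of V(G).
IsToken : ∀ {n} → ℕ → Subset n → Set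
IsToken k A = ∣ A ∣ ≡ k

TokenAdj : ∀ {n} → Graph n → Subset n → Subset n → Set
TokenAdj G A B = ∃[ u ] ∃[ v ] (u ≢ v × G u v × (A △ B ≡ ⁅ u ⁆ ∪ ⁅ v ⁆))

-- A dominating set of F_k(G), as a duplicate-free list of k-subsets
-- (its size is the length of the list).
IsDominatingSet : ∀ {n} → Graph n → ℕ → List (Subset n) → Set
IsDominatingSet G k D =
  Unique D × All (IsToken k) D ×
  (∀ B → IsToken k B → ∃[ A ] (A ∈ D × (A ≡ B ⊎ TokenAdj G A B)))

IsDominationNumber : ∀ {n} → Graph n → ℕ → ℕ → Set
IsDominationNumber G k m =
  (∃[ D ] (IsDominatingSet G k D × length D ≡ m)) ×
  (∀ D → IsDominatingSet G k D → m ≤ length D)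

{-# OPTIONS --safe #-}
module Submission where

-- Let D be a dominating set of F₃(Kₙ), call the union of the blocks of D through a
-- vertex y, minus y, the link of y, and let x be a vertex with a smallest link, W = {x} ∪ link x.
-- The block dominating a 3-set {x, y, z} contains two of its points, so if y, z ∉ W it contains
-- y and z: any two vertices outside W are linked. A vertex lying in d blocks has a link of size at
-- most 2d, so every vertex of W lies in at least ⌊a/2⌋ blocks and every other vertex in at least
-- ⌊b/2⌋ blocks, where a = |W| and b = n − a. Counting incidences, 3|D| ≥ a⌊a/2⌋ + b⌊b/2⌋, which is
-- at least (n² − 2n)/4, and at least (n² − 2n + 3)/4 when n is odd.
--
-- A 3-set is dominated by every 3-set sharing two of its points, and of any three
-- points two lie in the same half of a split of {1, …, n} into halves. Restricting to each half a
-- Steiner triple system of slightly larger order (Bose for orders 6k + 3, Skolem for 6k + 7) thus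
-- gives a dominating set of about n²/12 blocks, and of exactly (n² − 2n)/12 blocks when n/2 is
-- itself such an order, that is, when n ≡ 2, 6 (mod 12).

open import Defs

open import Data.Nat using (ℕ; zero; suc; pred; _+_; _*_; _∸_; _≤_; _<_; _≥_; z≤n; s≤s; s≤s⁻¹; _%_; ⌊_/2⌋; NonZero)
open import Data.Nat.Properties
open import Data.Nat.DivMod
  using (_/_; m*n%n≡0; [m+kn]%n≡m%n; [m+n]%n≡m%n; m%n<n; m<n⇒m%n≡m; m≡m%n+[m/n]*n; m<n*o⇒m/o<n;
         %-distribˡ-+; %-distribˡ-*; m%n%n≡m%n)
open import Data.Nat.Tactic.RingSolver using (solve-∀)
open import Algebra.Properties.CommutativeMonoid.Sum +-0-commutativeMonoid
  using (sum-syntax; ∑-distrib-+; sum-cong-≗; sum-replicate-zero)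
open import Algebra.Properties.CommutativeSemigroup +-commutativeSemigroup using (x∙yz≈y∙xz)
open import Data.Bool using (Bool; true; false; if_then_else_)
import Data.Bool.Properties as Bool
open import Data.Fin using (Fin; zero; suc; toℕ; fromℕ<)
open import Data.Fin.Patterns using (0F; 1F; 2F)
open import Data.Fin.Properties using (toℕ-fromℕ<; fromℕ<-toℕ; toℕ<n; toℕ-injective) renaming (_≟_ to _≟ᶠ_)
open import Data.Fin.Subset
  using (Subset; inside; outside; ⊥; ⁅_⁆; ∁; _∪_; _─_; _-_; ⋃; ∣_∣; _∈_; _∉_; _⊆_; Nonempty)
open import Data.Fin.Subset.Properties
open import Data.List using (List; []; _∷_; _++_; length; filter; map; allFin; upTo; deduplicate)
open import Data.List.Extrema.Nat using (argmin; f[argmin]≤f[xs])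
open import Data.List.Membership.Propositional using () renaming (_∈_ to _∈ₗ_)
open import Data.List.Membership.Propositional.Properties
  using (∈-allFin; ∈-++⁺ˡ; ∈-++⁺ʳ; ∈-map⁺; ∈-upTo⁺; ∈-deduplicate⁺)
open import Data.List.Properties using (length-++; length-map; length-upTo; length-filter)
import Data.List.Relation.Unary.Any as Any
open import Data.List.Relation.Unary.All using (All; []; _∷_)
import Data.List.Relation.Unary.All as All
import Data.List.Relation.Unary.All.Properties as All
open import Data.List.Relation.Unary.Unique.DecPropositional.Properties using (deduplicate-!)
open import Data.Product using (∃-syntax; _×_; _,_; proj₁; proj₂)
import Data.Product as Product
open import Data.Sum using (_⊎_; inj₁; inj₂; [_,_]; [_,_]′)
import Data.Sum as Sum
open import Data.Vec using ([]; _∷_; here; there)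
open import Data.Vec.Properties using (≡-dec)
open import Function using (_∘_)
open import Relation.Binary.Definitions using (DecidableEquality; tri<; tri≈; tri>)
open import Relation.Binary.PropositionalEquality hiding ([_])
open import Relation.Nullary using (¬_; Dec; yes; no; does; contradiction)

private variable
  n : ℕ
  p q r A B : Subset n
  x y z u v w w₁ w₂ : Fin n

-- Finite subsets

x∈p─q⇒x∉q : x ∈ p ─ q → x ∉ q
x∈p─q⇒x∉q {p = _ ∷ _} {q = outside ∷ _} here        ()
x∈p─q⇒x∉q {p = _ ∷ _} {q = _ ∷ _}       (there x∈) (there x∈q) = x∈p─q⇒x∉q x∈ x∈q

x∈p-y⇒x≢y : x ∈ p - y → x ≢ y
x∈p-y⇒x≢y = x∉⁅y⁆⇒x≢y ∘ x∈p─q⇒x∉q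

∣p∪q∣≤∣p∣+∣q∣ : ∀ (p q : Subset n) → ∣ p ∪ q ∣ ≤ ∣ p ∣ + ∣ q ∣
∣p∪q∣≤∣p∣+∣q∣ []            []            = z≤n
∣p∪q∣≤∣p∣+∣q∣ (inside  ∷ p) (inside  ∷ q) =
  s≤s (≤-trans (∣p∪q∣≤∣p∣+∣q∣ p q) (+-monoʳ-≤ ∣ p ∣ (n≤1+n _)))
∣p∪q∣≤∣p∣+∣q∣ (inside  ∷ p) (outside ∷ q) = s≤s (∣p∪q∣≤∣p∣+∣q∣ p q)
∣p∪q∣≤∣p∣+∣q∣ (outside ∷ p) (inside  ∷ q) =
  ≤-trans (s≤s (∣p∪q∣≤∣p∣+∣q∣ p q)) (≤-reflexive (sym (+-suc _ _)))
∣p∪q∣≤∣p∣+∣q∣ (outside ∷ p) (outside ∷ q) = ∣p∪q∣≤∣p∣+∣q∣ p q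

x∈p⇒∣p∣≡1+∣p-x∣ : x ∈ p → ∣ p ∣ ≡ suc ∣ p - x ∣
x∈p⇒∣p∣≡1+∣p-x∣ {p = inside  ∷ p} here        = cong (suc ∘ ∣_∣) (sym (p─⊥≡p p))
x∈p⇒∣p∣≡1+∣p-x∣ {p = inside  ∷ p} (there x∈p) = cong suc (x∈p⇒∣p∣≡1+∣p-x∣ x∈p)
x∈p⇒∣p∣≡1+∣p-x∣ {p = outside ∷ p} (there x∈p) = x∈p⇒∣p∣≡1+∣p-x∣ x∈p

x∉p⇒∣⁅x⁆∪p∣≡1+∣p∣ : x ∉ p → ∣ ⁅ x ⁆ ∪ p ∣ ≡ suc ∣ p ∣
x∉p⇒∣⁅x⁆∪p∣≡1+∣p∣ {x = zero}  {p = outside ∷ p} _   = cong (suc ∘ ∣_∣) (∪-identityˡ p)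
x∉p⇒∣⁅x⁆∪p∣≡1+∣p∣ {x = zero}  {p = inside  ∷ p} x∉p = contradiction here x∉p
x∉p⇒∣⁅x⁆∪p∣≡1+∣p∣ {x = suc x} {p = inside  ∷ p} x∉p = cong suc (x∉p⇒∣⁅x⁆∪p∣≡1+∣p∣ (x∉p ∘ there))
x∉p⇒∣⁅x⁆∪p∣≡1+∣p∣ {x = suc x} {p = outside ∷ p} x∉p = x∉p⇒∣⁅x⁆∪p∣≡1+∣p∣ (x∉p ∘ there)

⁅x⁆∪[p-x]≡p : x ∈ p → ⁅ x ⁆ ∪ (p - x) ≡ p
⁅x⁆∪[p-x]≡p {x = x} {p = p} x∈p = ⊆-antisym ⊆p p⊆
  where
  ⊆p : ⁅ x ⁆ ∪ (p - x) ⊆ p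
  ⊆p y∈ with x∈p∪q⁻ ⁅ x ⁆ (p - x) y∈
  ... | inj₁ y∈⁅x⁆ = subst (_∈ p) (sym (x∈⁅y⁆⇒x≡y x y∈⁅x⁆)) x∈p
  ... | inj₂ y∈p-x = p─q⊆p p ⁅ x ⁆ y∈p-x
  p⊆ : p ⊆ ⁅ x ⁆ ∪ (p - x)
  p⊆ {y} y∈p with y ≟ᶠ x
  ... | yes refl = x∈p∪q⁺ (inj₁ (x∈⁅x⁆ x))
  ... | no  y≢x  = x∈p∪q⁺ (inj₂ (x∈p∧x≢y⇒x∈p-y y∈p y≢x))

∣p∣≡0⇒p≡⊥ : ∣ p ∣ ≡ 0 → p ≡ ⊥
∣p∣≡0⇒p≡⊥ {p = p} ∣p∣≡0 =
  Empty-unique λ (x , x∈p) → n≮0 (subst (∣ p - x ∣ <_) ∣p∣≡0 (x∈p⇒∣p-x∣<∣p∣ x∈p))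

∣p∣≡1+k⇒Nonempty : ∀ {k} {p : Subset n} → ∣ p ∣ ≡ suc k → Nonempty p
∣p∣≡1+k⇒Nonempty {n = n} {p = p} ∣p∣≡1+k with nonempty? p
... | yes ne = ne
... | no ¬ne = contradiction (trans (sym ∣p∣≡1+k) (trans (cong ∣_∣ (Empty-unique ¬ne)) (∣⊥∣≡0 n))) λ ()

∣p∣≡1⇒p≡⁅x⁆ : ∣ p ∣ ≡ 1 → ∃[ x ] p ≡ ⁅ x ⁆
∣p∣≡1⇒p≡⁅x⁆ {p = p} ∣p∣≡1 with ∣p∣≡1+k⇒Nonempty ∣p∣≡1
... | x , x∈p = x , (begin
  p               ≡⟨ ⁅x⁆∪[p-x]≡p x∈p ⟨
  ⁅ x ⁆ ∪ (p - x) ≡⟨ cong (⁅ x ⁆ ∪_) (∣p∣≡0⇒p≡⊥ ∣p-x∣≡0) ⟩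
  ⁅ x ⁆ ∪ ⊥       ≡⟨ ∪-identityʳ ⁅ x ⁆ ⟩
  ⁅ x ⁆           ∎)
  where
  open ≡-Reasoning
  ∣p-x∣≡0 : ∣ p - x ∣ ≡ 0
  ∣p-x∣≡0 = suc-injective (trans (sym (x∈p⇒∣p∣≡1+∣p-x∣ x∈p)) ∣p∣≡1)

-- Triples and domination in F₃(Kₙ)

pair : Fin n → Fin n → Subset n
pair x y = ⁅ x ⁆ ∪ ⁅ y ⁆

triple : Fin n → Fin n → Fin n → Subset n
triple x y z = pair x y ∪ ⁅ z ⁆

∈pair⁻ : z ∈ pair x y → z ≡ x ⊎ z ≡ y
∈pair⁻ {x = x} {y = y} z∈ = Sum.map (x∈⁅y⁆⇒x≡y x) (x∈⁅y⁆⇒x≡y y) (x∈p∪q⁻ _ _ z∈)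

∉pair : z ≢ x → z ≢ y → z ∉ pair x y
∉pair z≢x z≢y z∈ = [ z≢x , z≢y ] (∈pair⁻ z∈)

∉triple : z ≢ x → z ≢ y → z ≢ w → z ∉ triple x y w
∉triple z≢x z≢y z≢w z∈ = [ ∉pair z≢x z≢y , z≢w ∘ x∈⁅y⁆⇒x≡y _ ] (x∈p∪q⁻ _ _ z∈)

∈pair-third : x ∈ pair u v → y ∈ pair u v → x ≢ y → z ∈ pair u v → z ≡ x ⊎ z ≡ y
∈pair-third x∈ y∈ x≢y z∈ with ∈pair⁻ x∈ | ∈pair⁻ y∈ | ∈pair⁻ z∈
... | inj₁ refl | inj₁ refl | _        = contradiction refl x≢y
... | inj₂ refl | inj₂ refl | _        = contradiction refl x≢y
... | inj₁ refl | inj₂ refl | inj₁ z≡u = inj₁ z≡u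
... | inj₁ refl | inj₂ refl | inj₂ z≡v = inj₂ z≡v
... | inj₂ refl | inj₁ refl | inj₁ z≡u = inj₂ z≡u
... | inj₂ refl | inj₁ refl | inj₂ z≡v = inj₁ z≡v

x∈triple : x ∈ triple x y z
x∈triple = x∈p∪q⁺ (inj₁ (x∈p∪q⁺ (inj₁ (x∈⁅x⁆ _))))

y∈triple : y ∈ triple x y z
y∈triple = x∈p∪q⁺ (inj₁ (x∈p∪q⁺ (inj₂ (x∈⁅x⁆ _))))

z∈triple : z ∈ triple x y z
z∈triple = x∈p∪q⁺ (inj₂ (x∈⁅x⁆ _))

∣triple∣≡3 : x ≢ y → x ≢ z → y ≢ z → ∣ triple x y z ∣ ≡ 3
∣triple∣≡3 {x = x} {y = y} {z = z} x≢y x≢z y≢z = begin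
  ∣ pair x y ∪ ⁅ z ⁆ ∣   ≡⟨ cong ∣_∣ (∪-comm (pair x y) ⁅ z ⁆) ⟩
  ∣ ⁅ z ⁆ ∪ pair x y ∣   ≡⟨ x∉p⇒∣⁅x⁆∪p∣≡1+∣p∣ (∉pair (x≢z ∘ sym) (y≢z ∘ sym)) ⟩
  suc ∣ ⁅ x ⁆ ∪ ⁅ y ⁆ ∣  ≡⟨ cong suc (x∉p⇒∣⁅x⁆∪p∣≡1+∣p∣ (x≢y⇒x∉⁅y⁆ x≢y)) ⟩
  suc (suc ∣ ⁅ y ⁆ ∣)    ≡⟨ cong (2 +_) (∣⁅x⁆∣≡1 y) ⟩
  3                      ∎
  where open ≡-Reasoning

⊇pair⇒≡triple : ∣ A ∣ ≡ 3 → u ∈ A → v ∈ A → u ≢ v → ∃[ w ] (w ≢ u × w ≢ v × A ≡ triple u v w)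
⊇pair⇒≡triple {A = A} {u = u} {v = v} ∣A∣≡3 u∈A v∈A u≢v = c , c≢u , c≢v , (begin
  A                               ≡⟨ ⁅x⁆∪[p-x]≡p u∈A ⟨
  ⁅ u ⁆ ∪ (A - u)                 ≡⟨ cong (⁅ u ⁆ ∪_) (⁅x⁆∪[p-x]≡p v∈A-u) ⟨
  ⁅ u ⁆ ∪ (⁅ v ⁆ ∪ (A - u - v))   ≡⟨ cong (λ s → ⁅ u ⁆ ∪ (⁅ v ⁆ ∪ s)) A-u-v≡⁅c⁆ ⟩
  ⁅ u ⁆ ∪ (⁅ v ⁆ ∪ ⁅ c ⁆)         ≡⟨ ∪-assoc ⁅ u ⁆ ⁅ v ⁆ ⁅ c ⁆ ⟨
  triple u v c                    ∎)
  where
  open ≡-Reasoning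
  v∈A-u : v ∈ A - u
  v∈A-u = x∈p∧x≢y⇒x∈p-y v∈A (u≢v ∘ sym)
  ∣A-u-v∣≡1 : ∣ A - u - v ∣ ≡ 1
  ∣A-u-v∣≡1 = suc-injective (suc-injective (begin
    suc (suc ∣ A - u - v ∣) ≡⟨ cong suc (x∈p⇒∣p∣≡1+∣p-x∣ v∈A-u) ⟨
    suc ∣ A - u ∣           ≡⟨ x∈p⇒∣p∣≡1+∣p-x∣ u∈A ⟨
    ∣ A ∣                   ≡⟨ ∣A∣≡3 ⟩
    3                       ∎))
  c : Fin _
  c = proj₁ (∣p∣≡1⇒p≡⁅x⁆ ∣A-u-v∣≡1)
  A-u-v≡⁅c⁆ : A - u - v ≡ ⁅ c ⁆
  A-u-v≡⁅c⁆ = proj₂ (∣p∣≡1⇒p≡⁅x⁆ ∣A-u-v∣≡1)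
  c∈A-u-v : c ∈ A - u - v
  c∈A-u-v = subst (c ∈_) (sym A-u-v≡⁅c⁆) (x∈⁅x⁆ c)
  c≢u : c ≢ u
  c≢u = x∈p-y⇒x≢y (p─q⊆p _ _ c∈A-u-v)
  c≢v : c ≢ v
  c≢v = x∈p-y⇒x≢y c∈A-u-v

∣p∣≡3⇒triple : ∣ B ∣ ≡ 3 → ∃[ x ] ∃[ y ] ∃[ z ] (x ≢ y × x ≢ z × y ≢ z × B ≡ triple x y z)
∣p∣≡3⇒triple {B = B} ∣B∣≡3 with ∣p∣≡1+k⇒Nonempty ∣B∣≡3
... | x , x∈B with ∣p∣≡1+k⇒Nonempty (suc-injective (trans (sym (x∈p⇒∣p∣≡1+∣p-x∣ x∈B)) ∣B∣≡3))
...   | y , y∈B-x with ⊇pair⇒≡triple ∣B∣≡3 x∈B (p─q⊆p B ⁅ x ⁆ y∈B-x) (x∈p-y⇒x≢y y∈B-x ∘ sym)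
...     | z , z≢x , z≢y , B≡ = x , y , z , x∈p-y⇒x≢y y∈B-x ∘ sym , z≢x ∘ sym , z≢y ∘ sym , B≡

Dominates : Subset n → Subset n → Set
Dominates {n} A B = A ≡ B ⊎ TokenAdj (K n) A B

Dominating : List (Subset n) → Set
Dominating {n} D = ∀ B → IsToken 3 B → ∃[ A ] (A ∈ₗ D × Dominates A B)

∈△⁺ˡ : x ∈ p → x ∉ q → x ∈ p △ q
∈△⁺ˡ x∈p x∉q = x∈p∪q⁺ (inj₁ (x∈p∧x∉q⇒x∈p─q x∈p x∉q))

∈△⁺ʳ : x ∈ q → x ∉ p → x ∈ p △ q
∈△⁺ʳ x∈q x∉p = x∈p∪q⁺ (inj₂ (x∈p∧x∉q⇒x∈p─q x∈q x∉p))

x∈[p∪q]─[p∪r]⇒x∈q : ∀ (p q r : Subset n) → x ∈ (p ∪ q) ─ (p ∪ r) → x ∈ q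
x∈[p∪q]─[p∪r]⇒x∈q p q r x∈ with x∈p∪q⁻ p q (p─q⊆p _ _ x∈)
... | inj₁ x∈p = contradiction (x∈p∪q⁺ (inj₁ x∈p)) (x∈p─q⇒x∉q x∈)
... | inj₂ x∈q = x∈q

∪-△-∪ : ∀ (p q r : Subset n) → (∀ {x} → x ∈ q → x ∉ p ∪ r) → (∀ {x} → x ∈ r → x ∉ p ∪ q) →
        (p ∪ q) △ (p ∪ r) ≡ q ∪ r
∪-△-∪ p q r q∉ r∉ = ⊆-antisym ⊆q∪r q∪r⊆
  where
  ⊆q∪r : (p ∪ q) △ (p ∪ r) ⊆ q ∪ r
  ⊆q∪r x∈ = x∈p∪q⁺ (Sum.map (x∈[p∪q]─[p∪r]⇒x∈q p q r) (x∈[p∪q]─[p∪r]⇒x∈q p r q) (x∈p∪q⁻ _ _ x∈))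
  q∪r⊆ : q ∪ r ⊆ (p ∪ q) △ (p ∪ r)
  q∪r⊆ x∈ with x∈p∪q⁻ q r x∈
  ... | inj₁ x∈q = ∈△⁺ˡ (x∈p∪q⁺ (inj₂ x∈q)) (q∉ x∈q)
  ... | inj₂ x∈r = ∈△⁺ʳ (x∈p∪q⁺ (inj₂ x∈r)) (r∉ x∈r)

sharedPair⇒Dominates : ∣ A ∣ ≡ 3 → ∣ B ∣ ≡ 3 → u ≢ v → u ∈ A → v ∈ A → u ∈ B → v ∈ B → Dominates A B
sharedPair⇒Dominates {u = u} {v = v} ∣A∣≡3 ∣B∣≡3 u≢v u∈A v∈A u∈B v∈B
  with ⊇pair⇒≡triple ∣A∣≡3 u∈A v∈A u≢v | ⊇pair⇒≡triple ∣B∣≡3 u∈B v∈B u≢v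
... | c , c≢u , c≢v , refl | w , w≢u , w≢v , refl with c ≟ᶠ w
...   | yes refl = inj₁ refl
...   | no  c≢w  = inj₂ (c , w , c≢w , c≢w , ∪-△-∪ (pair u v) ⁅ c ⁆ ⁅ w ⁆ c∉ w∉)
  where
  c∉ : x ∈ ⁅ c ⁆ → x ∉ triple u v w
  c∉ x∈ rewrite x∈⁅y⁆⇒x≡y c x∈ = ∉triple c≢u c≢v c≢w
  w∉ : x ∈ ⁅ w ⁆ → x ∉ triple u v c
  w∉ x∈ rewrite x∈⁅y⁆⇒x≡y w x∈ = ∉triple w≢u w≢v (c≢w ∘ sym)

missingTwo⇒¬Dominates : ∣ A ∣ ≡ ∣ B ∣ → w₁ ≢ w₂ → w₁ ∈ B → w₂ ∈ B → w₁ ∉ A → w₂ ∉ A → ¬ Dominates A B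
missingTwo⇒¬Dominates _ _ w₁∈B _ w₁∉A _ (inj₁ refl) = w₁∉A w₁∈B
missingTwo⇒¬Dominates {A = A} {B = B} {w₁ = w₁} {w₂ = w₂} ∣A∣≡∣B∣ w₁≢w₂ w₁∈B w₂∈B w₁∉A w₂∉A
                      (inj₂ (u , v , _ , _ , A△B≡uv)) = 1+n≰n (begin
  suc (suc ∣ B - w₁ - w₂ ∣) ≡⟨ cong suc (x∈p⇒∣p∣≡1+∣p-x∣ w₂∈B-w₁) ⟨
  suc ∣ B - w₁ ∣            ≡⟨ x∈p⇒∣p∣≡1+∣p-x∣ w₁∈B ⟨
  ∣ B ∣                     ≡⟨ ∣A∣≡∣B∣ ⟨
  ∣ A ∣                     ≤⟨ p⊆q⇒∣p∣≤∣q∣ A⊆B-w₁-w₂ ⟩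
  ∣ B - w₁ - w₂ ∣           ≤⟨ n≤1+n _ ⟩
  suc ∣ B - w₁ - w₂ ∣       ∎)
  where
  open ≤-Reasoning
  w₂∈B-w₁ : w₂ ∈ B - w₁
  w₂∈B-w₁ = x∈p∧x≢y⇒x∈p-y w₂∈B (w₁≢w₂ ∘ sym)
  ∈uv : x ∈ A △ B → x ∈ pair u v
  ∈uv = subst (_ ∈_) A△B≡uv
  A⊆B : A ⊆ B
  A⊆B {x} x∈A with x ∈? B
  ... | yes x∈B = x∈B
  ... | no  x∉B
    with ∈pair-third (∈uv (∈△⁺ʳ w₁∈B w₁∉A)) (∈uv (∈△⁺ʳ w₂∈B w₂∉A)) w₁≢w₂ (∈uv (∈△⁺ˡ x∈A x∉B))
  ...   | inj₁ refl = contradiction x∈A w₁∉A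
  ...   | inj₂ refl = contradiction x∈A w₂∉A
  A⊆B-w₁-w₂ : A ⊆ B - w₁ - w₂
  A⊆B-w₁-w₂ x∈A =
    x∈p∧x≢y⇒x∈p-y (x∈p∧x≢y⇒x∈p-y (A⊆B x∈A) λ { refl → w₁∉A x∈A }) λ { refl → w₂∉A x∈A }

-- The lower bound

blocksThrough : Fin n → List (Subset n) → List (Subset n)
blocksThrough y = filter (y ∈?_)

degree : Fin n → List (Subset n) → ℕ
degree y D = length (blocksThrough y D)

link : Fin n → List (Subset n) → Subset n
link y D = ⋃ (map (_- y) (blocksThrough y D))

∈-link : {D : List (Subset n)} → A ∈ₗ D → y ∈ A → z ∈ A → z ≢ y → z ∈ link y D
∈-link {y = y} {D = B ∷ D} (Any.here refl) y∈A z∈A z≢y with y ∈? B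
... | yes _   = x∈p∪q⁺ (inj₁ (x∈p∧x≢y⇒x∈p-y z∈A z≢y))
... | no y∉A  = contradiction y∈A y∉A
∈-link {y = y} {D = B ∷ D} (Any.there A∈D) y∈A z∈A z≢y with y ∈? B
... | yes _ = x∈p∪q⁺ (inj₂ (∈-link A∈D y∈A z∈A z≢y))
... | no  _ = ∈-link A∈D y∈A z∈A z≢y

∣link∣≤degree*2 : {D : List (Subset n)} → All (IsToken 3) D → ∣ link y D ∣ ≤ degree y D * 2
∣link∣≤degree*2 {n = n} [] = ≤-reflexive (∣⊥∣≡0 n)
∣link∣≤degree*2 {y = y} {D = A ∷ D} (∣A∣≡3 ∷ D-3) with y ∈? A
... | no  _   = ∣link∣≤degree*2 D-3
... | yes y∈A = ≤-trans (∣p∪q∣≤∣p∣+∣q∣ (A - y) (link y D)) (+-mono-≤ ∣A-y∣≤2 (∣link∣≤degree*2 D-3))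
  where
  ∣A-y∣≤2 : ∣ A - y ∣ ≤ 2
  ∣A-y∣≤2 = ≤-reflexive (suc-injective (trans (sym (x∈p⇒∣p∣≡1+∣p-x∣ y∈A)) ∣A∣≡3))

degree-∷ : ∀ y A (D : List (Subset n)) → degree y (A ∷ D) ≡ (if does (y ∈? A) then 1 else 0) + degree y D
degree-∷ y A D with does (y ∈? A)
... | true  = refl
... | false = refl

∑-if-∈? : ∀ (p : Subset n) α β → ∑[ y < n ] (if does (y ∈? p) then α else β) ≡ ∣ p ∣ * α + ∣ ∁ p ∣ * β
∑-if-∈? []            α β = refl
∑-if-∈? (inside  ∷ p) α β = trans (cong (α +_) (∑-if-∈? p α β)) (sym (+-assoc α (∣ p ∣ * α) (∣ ∁ p ∣ * β)))
∑-if-∈? (outside ∷ p) α β = trans (cong (β +_) (∑-if-∈? p α β)) (x∙yz≈y∙xz β (∣ p ∣ * α) (∣ ∁ p ∣ * β))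

∑-∈? : ∀ (p : Subset n) → ∑[ y < n ] (if does (y ∈? p) then 1 else 0) ≡ ∣ p ∣
∑-∈? p = trans (∑-if-∈? p 1 0) (trans (cong₂ _+_ (*-identityʳ ∣ p ∣) (*-zeroʳ ∣ ∁ p ∣)) (+-identityʳ ∣ p ∣))

∑-degree : ∀ {k} {D : List (Subset n)} → All (IsToken k) D → ∑[ y < n ] degree y D ≡ k * length D
∑-degree {n} {k} [] = trans (sum-replicate-zero n) (sym (*-zeroʳ k))
∑-degree {n} {k} {A ∷ D} (∣A∣≡k ∷ D-k) = begin
  ∑[ y < n ] degree y (A ∷ D)
    ≡⟨ sum-cong-≗ (λ y → degree-∷ y A D) ⟩
  ∑[ y < n ] ((if does (y ∈? A) then 1 else 0) + degree y D)
    ≡⟨ ∑-distrib-+ (λ y → if does (y ∈? A) then 1 else 0) (λ y → degree y D) ⟩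
  ∑[ y < n ] (if does (y ∈? A) then 1 else 0) + ∑[ y < n ] degree y D
    ≡⟨ cong₂ _+_ (trans (∑-∈? A) ∣A∣≡k) (∑-degree D-k) ⟩
  k + k * length D
    ≡⟨ *-suc k (length D) ⟨
  k * suc (length D)
    ∎
  where open ≡-Reasoning

dominator⊇pair : ∣ A ∣ ≡ 3 → x ≢ y → x ≢ z → y ≢ z → Dominates A (triple x y z) →
                 (x ∈ A × y ∈ A) ⊎ (x ∈ A × z ∈ A) ⊎ (y ∈ A × z ∈ A)
dominator⊇pair {A = A} {x = x} {y = y} {z = z} ∣A∣≡3 x≢y x≢z y≢z A⇉xyz = go (x ∈? A) (y ∈? A) (z ∈? A)
  where
  missing : w₁ ≢ w₂ → w₁ ∈ triple x y z → w₂ ∈ triple x y z → w₁ ∉ A → w₂ ∉ A → ¬ Dominates A (triple x y z)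
  missing = missingTwo⇒¬Dominates (trans ∣A∣≡3 (sym (∣triple∣≡3 x≢y x≢z y≢z)))
  go : Dec (x ∈ A) → Dec (y ∈ A) → Dec (z ∈ A) → (x ∈ A × y ∈ A) ⊎ (x ∈ A × z ∈ A) ⊎ (y ∈ A × z ∈ A)
  go (yes x∈A) (yes y∈A) _         = inj₁ (x∈A , y∈A)
  go (yes x∈A) (no  _)   (yes z∈A) = inj₂ (inj₁ (x∈A , z∈A))
  go _         (yes y∈A) (yes z∈A) = inj₂ (inj₂ (y∈A , z∈A))
  go (yes _)   (no  y∉A) (no  z∉A) = contradiction A⇉xyz (missing y≢z y∈triple z∈triple y∉A z∉A)
  go (no  x∉A) (no  y∉A) _         = contradiction A⇉xyz (missing x≢y x∈triple y∈triple x∉A y∉A)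
  go (no  x∉A) (yes _)   (no  z∉A) = contradiction A⇉xyz (missing x≢z x∈triple z∈triple x∉A z∉A)

outsideLink⇒inLink : {D : List (Subset n)} → All (IsToken 3) D → Dominating D → x ≢ y → x ≢ z → y ≢ z →
                     y ∉ link x D → z ∉ link x D → z ∈ link y D
outsideLink⇒inLink {x = x} {y = y} {z = z} D-3 dom x≢y x≢z y≢z y∉ z∉
  with dom (triple x y z) (∣triple∣≡3 x≢y x≢z y≢z)
... | A , A∈D , A⇉xyz with dominator⊇pair (All.lookup D-3 A∈D) x≢y x≢z y≢z A⇉xyz
...   | inj₁ (x∈A , y∈A)        = contradiction (∈-link A∈D x∈A y∈A (x≢y ∘ sym)) y∉
...   | inj₂ (inj₁ (x∈A , z∈A)) = contradiction (∈-link A∈D x∈A z∈A (x≢z ∘ sym)) z∉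
...   | inj₂ (inj₂ (y∈A , z∈A)) = ∈-link A∈D y∈A z∈A (y≢z ∘ sym)

∑-mono-≤ : {f g : Fin n → ℕ} → (∀ i → f i ≤ g i) → ∑[ i < n ] f i ≤ ∑[ i < n ] g i
∑-mono-≤ {zero}  _   = z≤n
∑-mono-≤ {suc n} f≤g = +-mono-≤ (f≤g zero) (∑-mono-≤ (f≤g ∘ suc))

⌊1+d*2/2⌋≡d : ∀ d → ⌊ suc (d * 2) /2⌋ ≡ d
⌊1+d*2/2⌋≡d zero    = refl
⌊1+d*2/2⌋≡d (suc d) = cong suc (⌊1+d*2/2⌋≡d d)

m≤1+d*2⇒⌊m/2⌋≤d : ∀ {m} d → m ≤ suc (d * 2) → ⌊ m /2⌋ ≤ d
m≤1+d*2⇒⌊m/2⌋≤d d m≤ = ≤-trans (⌊n/2⌋-mono m≤) (≤-reflexive (⌊1+d*2/2⌋≡d d))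

incidenceBound : ∀ {n} {D : List (Subset n)} → All (IsToken 3) D → Dominating D →
                 ∀ x₀ → (∀ y → ∣ link x₀ D ∣ ≤ ∣ link y D ∣) →
                 ∃[ a ] ∃[ b ] (a + b ≡ n × a * ⌊ a /2⌋ + b * ⌊ b /2⌋ ≤ 3 * length D)
incidenceBound {n} {D} D-3 dom x₀ x₀-minimal = a , b , a+b≡n , (begin
  a * ⌊ a /2⌋ + b * ⌊ b /2⌋                                ≡⟨ ∑-if-∈? W ⌊ a /2⌋ ⌊ b /2⌋ ⟨
  ∑[ y < n ] (if does (y ∈? W) then ⌊ a /2⌋ else ⌊ b /2⌋) ≤⟨ ∑-mono-≤ bound ⟩
  ∑[ y < n ] degree y D                                    ≡⟨ ∑-degree D-3 ⟩
  3 * length D                                             ∎)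
  where
  open ≤-Reasoning
  W : Subset n
  W = ⁅ x₀ ⁆ ∪ link x₀ D
  a b : ℕ
  a = ∣ W ∣
  b = ∣ ∁ W ∣
  a+b≡n : a + b ≡ n
  a+b≡n = trans (cong (a +_) (∣∁p∣≡n∸∣p∣ W)) (m+[n∸m]≡n (∣p∣≤n W))
  degree-bound : ∀ {m y} → m ≤ suc ∣ link y D ∣ → ⌊ m /2⌋ ≤ degree y D
  degree-bound {y = y} m≤ = m≤1+d*2⇒⌊m/2⌋≤d (degree y D) (≤-trans m≤ (s≤s (∣link∣≤degree*2 D-3)))
  a-bound : ∀ y → a ≤ suc ∣ link y D ∣
  a-bound y = ≤-trans (∣p∪q∣≤∣p∣+∣q∣ ⁅ x₀ ⁆ (link x₀ D))
                      (≤-trans (≤-reflexive (cong (_+ ∣ link x₀ D ∣) (∣⁅x⁆∣≡1 x₀))) (s≤s (x₀-minimal y)))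
  ∉W : ∀ {y} → y ∈ ∁ W → y ≢ x₀ × y ∉ link x₀ D
  ∉W y∈∁W = (λ { refl → x∈p⇒x∉∁p (x∈p∪q⁺ (inj₁ (x∈⁅x⁆ x₀))) y∈∁W }) ,
            (λ y∈ → x∈p⇒x∉∁p (x∈p∪q⁺ (inj₂ y∈)) y∈∁W)
  b-bound : ∀ {y} → y ∈ ∁ W → b ≤ suc ∣ link y D ∣
  b-bound {y} y∈∁W = ≤-trans (≤-reflexive (x∈p⇒∣p∣≡1+∣p-x∣ y∈∁W)) (s≤s (p⊆q⇒∣p∣≤∣q∣ ∁W-y⊆link))
    where
    ∁W-y⊆link : ∁ W - y ⊆ link y D
    ∁W-y⊆link z∈ with ∉W y∈∁W | ∉W (p─q⊆p _ _ z∈)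
    ... | y≢x , y∉ | z≢x , z∉ = outsideLink⇒inLink D-3 dom (y≢x ∘ sym) (z≢x ∘ sym) (x∈p-y⇒x≢y z∈ ∘ sym) y∉ z∉
  bound : ∀ y → (if does (y ∈? W) then ⌊ a /2⌋ else ⌊ b /2⌋) ≤ degree y D
  bound y with y ∈? W
  ... | yes _  = degree-bound (a-bound y)
  ... | no y∉W = degree-bound (b-bound (x∉p⇒x∈∁p y∉W))

-- Arithmetic of the lower bound

data Parity : ℕ → Set where
  even : ∀ k → Parity (k * 2)
  odd  : ∀ k → Parity (suc (k * 2))

parity : ∀ m → Parity m
parity zero = even 0
parity (suc m) with parity m
... | even k = odd k
... | odd  k = even (suc k)

⌊k*2/2⌋≡k : ∀ k → ⌊ k * 2 /2⌋ ≡ k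
⌊k*2/2⌋≡k zero    = refl
⌊k*2/2⌋≡k (suc k) = cong suc (⌊k*2/2⌋≡k k)

[p+q]²≤2[p²+q²] : ∀ p q → (p + q) * (p + q) ≤ 2 * (p * p + q * q)
[p+q]²≤2[p²+q²] p q = [ ordered , swapped ]′ (≤-total p q)
  where
  identity : ∀ p d → (p + (p + d)) * (p + (p + d)) + d * d ≡ 2 * (p * p + (p + d) * (p + d))
  identity = solve-∀
  ordered : ∀ {p q} → p ≤ q → (p + q) * (p + q) ≤ 2 * (p * p + q * q)
  ordered {p} p≤q with m≤n⇒∃[o]m+o≡n p≤q
  ... | d , refl = ≤-trans (m≤m+n _ (d * d)) (≤-reflexive (identity p d))
  swapped : q ≤ p → (p + q) * (p + q) ≤ 2 * (p * p + q * q)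
  swapped q≤p = subst₂ _≤_ (cong (λ s → s * s) (+-comm q p)) (cong (2 *_) (+-comm (q * q) (p * p))) (ordered q≤p)

even+even-bound : ∀ p q → let n = p * 2 + q * 2 in n * n ≤ 2 * n + 4 * (p * 2 * p + q * 2 * q)
even+even-bound p q = begin
  (p * 2 + q * 2) * (p * 2 + q * 2)     ≡⟨ identity₁ p q ⟩
  4 * ((p + q) * (p + q))               ≤⟨ *-monoʳ-≤ 4 ([p+q]²≤2[p²+q²] p q) ⟩
  4 * (2 * (p * p + q * q))             ≡⟨ identity₂ p q ⟩
  4 * (p * 2 * p + q * 2 * q)           ≤⟨ m≤n+m (4 * (p * 2 * p + q * 2 * q)) (2 * (p * 2 + q * 2)) ⟩
  2 * (p * 2 + q * 2) + 4 * (p * 2 * p + q * 2 * q) ∎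
  where
  open ≤-Reasoning
  identity₁ : ∀ p q → (p * 2 + q * 2) * (p * 2 + q * 2) ≡ 4 * ((p + q) * (p + q))
  identity₁ = solve-∀
  identity₂ : ∀ p q → 4 * (2 * (p * p + q * q)) ≡ 4 * (p * 2 * p + q * 2 * q)
  identity₂ = solve-∀

odd+odd-bound : ∀ p q → let n = suc (p * 2) + suc (q * 2) in n * n ≤ 2 * n + 4 * (suc (p * 2) * p + suc (q * 2) * q)
odd+odd-bound p q = begin
  N * N                                           ≡⟨ identity₁ p q ⟩
  4 * ((p + q) * (p + q)) + (8 * (p + q) + 4)     ≤⟨ +-monoˡ-≤ _ (*-monoʳ-≤ 4 ([p+q]²≤2[p²+q²] p q)) ⟩
  4 * (2 * (p * p + q * q)) + (8 * (p + q) + 4)   ≡⟨ identity₂ p q ⟩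
  2 * N + 4 * (suc (p * 2) * p + suc (q * 2) * q) ∎
  where
  open ≤-Reasoning
  N : ℕ
  N = suc (p * 2) + suc (q * 2)
  identity₁ : ∀ p q → (suc (p * 2) + suc (q * 2)) * (suc (p * 2) + suc (q * 2)) ≡ 4 * ((p + q) * (p + q)) + (8 * (p + q) + 4)
  identity₁ = solve-∀
  identity₂ : ∀ p q → 4 * (2 * (p * p + q * q)) + (8 * (p + q) + 4) ≡ 2 * (suc (p * 2) + suc (q * 2)) + 4 * (suc (p * 2) * p + suc (q * 2) * q)
  identity₂ = solve-∀

odd+even-bound : ∀ p q → let n = suc (p * 2) + q * 2 in 3 ≤ n → n * n + 3 ≤ 2 * n + 4 * (suc (p * 2) * p + q * 2 * q)
odd+even-bound p q 3≤n = begin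
  N * N + 3                                               ≡⟨ identity₁ p q ⟩
  4 * ((p + q) * (p + q)) + 2 + (4 * (p + q) + 2)         ≤⟨ +-monoˡ-≤ _ (squareSlack p q 3≤n) ⟩
  4 * (2 * (p * p + q * q)) + 4 * p + (4 * (p + q) + 2)   ≡⟨ identity₂ p q ⟩
  2 * N + 4 * (suc (p * 2) * p + q * 2 * q)               ∎
  where
  open ≤-Reasoning
  N : ℕ
  N = suc (p * 2) + q * 2
  2≤4*[1+k] : ∀ k → 2 ≤ 4 * suc k
  2≤4*[1+k] k = ≤-trans (s≤s (s≤s z≤n)) (*-monoʳ-≤ 4 (s≤s (z≤n {k})))
  identity₁ : ∀ p q → (suc (p * 2) + q * 2) * (suc (p * 2) + q * 2) + 3 ≡ 4 * ((p + q) * (p + q)) + 2 + (4 * (p + q) + 2)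
  identity₁ = solve-∀
  identity₂ : ∀ p q → 4 * (2 * (p * p + q * q)) + 4 * p + (4 * (p + q) + 2) ≡ 2 * (suc (p * 2) + q * 2) + 4 * (suc (p * 2) * p + q * 2 * q)
  identity₂ = solve-∀
  -- The slack 2 comes from the odd part a = 2p + 1 when p ≥ 1, and from b = 2q ≥ 2 when p = 0.
  squareSlack : ∀ p q → 3 ≤ suc (p * 2) + q * 2 → 4 * ((p + q) * (p + q)) + 2 ≤ 4 * (2 * (p * p + q * q)) + 4 * p
  squareSlack (suc p) q _ = +-mono-≤ (*-monoʳ-≤ 4 ([p+q]²≤2[p²+q²] (suc p) q)) (2≤4*[1+k] p)
  squareSlack zero zero (s≤s ())
  squareSlack zero (suc q) _ = ≤-trans (+-monoʳ-≤ (4 * (suc q * suc q)) (2≤4*[1+k] (q + q * suc q)))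
                                       (≤-reflexive (identity₃ q))
    where
    identity₃ : ∀ q → 4 * (suc q * suc q) + 4 * (suc q * suc q) ≡ 4 * (2 * (0 * 0 + suc q * suc q)) + 4 * 0
    identity₃ = solve-∀

[k*2]%2≡0 : ∀ k → (k * 2) % 2 ≡ 0
[k*2]%2≡0 k = m*n%n≡0 k 2

[1+k*2]%2≡1 : ∀ k → suc (k * 2) % 2 ≡ 1
[1+k*2]%2≡1 k = [m+kn]%n≡m%n 1 k 2

∸-bound : ∀ n {X} → n * n ≤ 2 * n + X → n * n ∸ 2 * n ≤ X
∸-bound n = m≤n+o⇒m∸n≤o (n * n) (2 * n)

∸-bound+3 : ∀ n {X} → 3 ≤ n → n * n + 3 ≤ 2 * n + X → n * n ∸ 2 * n + 3 ≤ X
∸-bound+3 n {X} 3≤n n²+3≤2n+X =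
  subst (_≤ X) (+-∸-comm 3 (*-monoˡ-≤ n (≤-trans (n≤1+n 2) 3≤n))) (m≤n+o⇒m∸n≤o (n * n + 3) (2 * n) n²+3≤2n+X)

SplitBound : ℕ → ℕ → Set
SplitBound a b = (N % 2 ≡ 0 → N * N ∸ 2 * N ≤ 4 * S) × (N % 2 ≡ 1 → N * N ∸ 2 * N + 3 ≤ 4 * S)
  where
  N S : ℕ
  N = a + b
  S = a * ⌊ a /2⌋ + b * ⌊ b /2⌋

SplitBound-comm : ∀ a b → SplitBound a b → SplitBound b a
SplitBound-comm a b = subst₂ (λ n S → (n % 2 ≡ 0 → n * n ∸ 2 * n ≤ 4 * S) × (n % 2 ≡ 1 → n * n ∸ 2 * n + 3 ≤ 4 * S))
                             (+-comm a b) (+-comm (a * ⌊ a /2⌋) (b * ⌊ b /2⌋))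

odd+even-split : ∀ p q → 3 ≤ suc (p * 2) + q * 2 → SplitBound (suc (p * 2)) (q * 2)
odd+even-split p q 3≤n rewrite ⌊1+d*2/2⌋≡d p | ⌊k*2/2⌋≡k q =
  (λ n%2≡0 → contradiction (trans (sym n%2≡0) n%2≡1) 0≢1+n) ,
  (λ _ → ∸-bound+3 (suc (p * 2) + q * 2) 3≤n (odd+even-bound p q 3≤n))
  where
  n%2≡1 : (suc (p * 2) + q * 2) % 2 ≡ 1
  n%2≡1 = trans (cong (λ m → suc m % 2) (sym (*-distribʳ-+ 2 p q))) ([1+k*2]%2≡1 (p + q))

lowerBound-arith : ∀ a b → 3 ≤ a + b → SplitBound a b
lowerBound-arith a b 3≤n with parity a | parity b
... | even p | even q rewrite ⌊k*2/2⌋≡k p | ⌊k*2/2⌋≡k q =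
  (λ _ → ∸-bound (p * 2 + q * 2) (even+even-bound p q)) ,
  (λ n%2≡1 → contradiction (trans (sym n%2≡0) n%2≡1) 0≢1+n)
  where
  n%2≡0 : (p * 2 + q * 2) % 2 ≡ 0
  n%2≡0 = trans (cong (_% 2) (sym (*-distribʳ-+ 2 p q))) ([k*2]%2≡0 (p + q))
... | odd p | odd q rewrite ⌊1+d*2/2⌋≡d p | ⌊1+d*2/2⌋≡d q =
  (λ _ → ∸-bound (suc (p * 2) + suc (q * 2)) (odd+odd-bound p q)) ,
  (λ n%2≡1 → contradiction (trans (sym n%2≡0) n%2≡1) 0≢1+n)
  where
  identity : ∀ p q → suc (p * 2) + suc (q * 2) ≡ suc (p + q) * 2
  identity = solve-∀
  n%2≡0 : (suc (p * 2) + suc (q * 2)) % 2 ≡ 0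
  n%2≡0 = trans (cong (_% 2) (identity p q)) ([k*2]%2≡0 (suc (p + q)))
... | odd p | even q = odd+even-split p q 3≤n
... | even p | odd q = SplitBound-comm (suc (q * 2)) (p * 2) (odd+even-split q p (subst (3 ≤_) (+-comm (p * 2) _) 3≤n))

∃-argmin : (f : Fin (suc n) → ℕ) → ∃[ x ] (∀ y → f x ≤ f y)
∃-argmin f = argmin f zero (allFin _) , λ y → All.lookup (f[argmin]≤f[xs] {f = f} zero (allFin _)) (∈-allFin y)

lowerBound-fromCount : ∀ {n d} → 3 ≤ n → ∃[ a ] ∃[ b ] (a + b ≡ n × a * ⌊ a /2⌋ + b * ⌊ b /2⌋ ≤ 3 * d) →
                       (n % 2 ≡ 0 → n * n ∸ 2 * n ≤ 12 * d) × (n % 2 ≡ 1 → n * n ∸ 2 * n + 3 ≤ 12 * d)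
lowerBound-fromCount {d = d} 3≤n (a , b , refl , S≤3d) =
  Product.map (λ bound even → ≤-trans (bound even) 4S≤12d) (λ bound odd → ≤-trans (bound odd) 4S≤12d)
              (lowerBound-arith a b 3≤n)
  where
  4S≤12d : 4 * (a * ⌊ a /2⌋ + b * ⌊ b /2⌋) ≤ 12 * d
  4S≤12d = ≤-trans (*-monoʳ-≤ 4 S≤3d) (≤-reflexive (sym (*-assoc 4 3 d)))

lowerBound : ∀ n → n ≥ 4 → ∀ D → IsDominatingSet (K n) 3 D →
             (n % 2 ≡ 0 → n * n ∸ 2 * n ≤ 12 * length D) × (n % 2 ≡ 1 → n * n ∸ 2 * n + 3 ≤ 12 * length D)
lowerBound (suc n) n≥4 D (_ , D-3 , dom) =
  lowerBound-fromCount {d = length D} (≤-trans (n≤1+n 3) n≥4) (incidenceBound D-3 dom (proj₁ x₀) (proj₂ x₀))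
  where
  x₀ : ∃[ x ] (∀ y → ∣ link x D ∣ ≤ ∣ link y D ∣)
  x₀ = ∃-argmin (λ y → ∣ link y D ∣)

-- Steiner triple systems

Triple : Set
Triple = ℕ × ℕ × ℕ

_∈ₜ_ : ℕ → Triple → Set
a ∈ₜ (p , q , r) = a ≡ p ⊎ a ≡ q ⊎ a ≡ r

PairCovered : List Triple → ℕ → ℕ → Set
PairCovered L a b = ∃[ t ] (t ∈ₗ L × a ∈ₜ t × b ∈ₜ t)

CoversPairs : ℕ → List Triple → Set
CoversPairs v L = ∀ {a b} → a < v → b < v → a ≢ b → PairCovered L a b

-- Covering the pairs of v points by v(v − 1)/6 triples forces every pair to be covered exactly
-- once, so these are precisely the Steiner triple systems of order v.
record SteinerTripleSystem (v : ℕ) : Set where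
  field
    blocks : List Triple
    covers : CoversPairs v blocks
    size   : 6 * length blocks + v ≡ v * v

module _ {a b : ℕ} where

  PairCovered-swap : ∀ {L} → PairCovered L a b → PairCovered L b a
  PairCovered-swap (t , t∈ , a∈ , b∈) = t , t∈ , b∈ , a∈

  PairCovered-++ˡ : ∀ {L L′} → PairCovered L a b → PairCovered (L ++ L′) a b
  PairCovered-++ˡ (t , t∈ , ab∈) = t , ∈-++⁺ˡ t∈ , ab∈

  PairCovered-++ʳ : ∀ L {L′} → PairCovered L′ a b → PairCovered (L ++ L′) a b
  PairCovered-++ʳ L (t , t∈ , ab∈) = t , ∈-++⁺ʳ L t∈ , ab∈

pairsBelow : ℕ → List (ℕ × ℕ)
pairsBelow zero    = []
pairsBelow (suc m) = pairsBelow m ++ map (_, m) (upTo m)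

∈-pairsBelow : ∀ {x y m} → x < y → y < m → (x , y) ∈ₗ pairsBelow m
∈-pairsBelow {m = suc m} x<y y<1+m with m<1+n⇒m<n∨m≡n y<1+m
... | inj₁ y<m  = ∈-++⁺ˡ (∈-pairsBelow x<y y<m)
... | inj₂ refl = ∈-++⁺ʳ (pairsBelow m) (∈-map⁺ (_, _) (∈-upTo⁺ x<y))

length-pairsBelow : ∀ m → 2 * length (pairsBelow m) + m ≡ m * m
length-pairsBelow zero    = refl
length-pairsBelow (suc m) = begin
  2 * length (pairsBelow m ++ map (_, m) (upTo m)) + suc m
    ≡⟨ cong (λ l → 2 * l + suc m) (trans (length-++ (pairsBelow m)) (cong (P +_) (trans (length-map _ (upTo m)) (length-upTo m)))) ⟩
  2 * (P + m) + suc m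
    ≡⟨ identity₁ P m ⟩
  (2 * P + m) + (2 * m + 1)
    ≡⟨ cong (_+ (2 * m + 1)) (length-pairsBelow m) ⟩
  m * m + (2 * m + 1)
    ≡⟨ identity₂ m ⟩
  suc m * suc m
    ∎
  where
  open ≡-Reasoning
  P : ℕ
  P = length (pairsBelow m)
  identity₁ : ∀ P m → 2 * (P + m) + suc m ≡ (2 * P + m) + (2 * m + 1)
  identity₁ = solve-∀
  identity₂ : ∀ m → m * m + (2 * m + 1) ≡ suc m * suc m
  identity₂ = solve-∀

module _ {A : Set} where

  onEachLevel : (Fin 3 → List A) → List A
  onEachLevel f = f 0F ++ f 1F ++ f 2F

  ∈-onEachLevel : ∀ (f : Fin 3 → List A) {a} i → a ∈ₗ f i → a ∈ₗ onEachLevel f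
  ∈-onEachLevel f 0F a∈ = ∈-++⁺ˡ a∈
  ∈-onEachLevel f 1F a∈ = ∈-++⁺ʳ (f 0F) (∈-++⁺ˡ a∈)
  ∈-onEachLevel f 2F a∈ = ∈-++⁺ʳ (f 0F) (∈-++⁺ʳ (f 1F) a∈)

  length-onEachLevel : ∀ (f : Fin 3 → List A) c → (∀ i → length (f i) ≡ c) → length (onEachLevel f) ≡ 3 * c
  length-onEachLevel f c ∣f∣≡c = begin
    length (f 0F ++ f 1F ++ f 2F)                   ≡⟨ length-++ (f 0F) ⟩
    length (f 0F) + length (f 1F ++ f 2F)           ≡⟨ cong (length (f 0F) +_) (length-++ (f 1F)) ⟩
    length (f 0F) + (length (f 1F) + length (f 2F)) ≡⟨ cong₂ _+_ (∣f∣≡c 0F) (cong₂ _+_ (∣f∣≡c 1F) (∣f∣≡c 2F)) ⟩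
    c + (c + c)                                     ≡⟨ cong (λ d → c + (c + d)) (+-identityʳ c) ⟨
    3 * c                                           ∎
    where open ≡-Reasoning

-- The point set ℤ_m × ℤ_3 of the Bose and Skolem constructions, with (x, i) encoded as x + i m.
module Levels (m : ℕ) .{{_ : NonZero m}} where

  point : ℕ → Fin 3 → ℕ
  point x i = x + toℕ i * m

  next : Fin 3 → Fin 3
  next 0F = 1F
  next 1F = 2F
  next 2F = 0F

  prev : Fin 3 → Fin 3
  prev 0F = 2F
  prev 1F = 0F
  prev 2F = 1F

  next-prev : ∀ i → next (prev i) ≡ i
  next-prev 0F = refl
  next-prev 1F = refl
  next-prev 2F = refl

  sameOrAdjacent : ∀ (i j : Fin 3) → i ≡ j ⊎ j ≡ next i ⊎ i ≡ next j
  sameOrAdjacent 0F 0F = inj₁ refl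
  sameOrAdjacent 0F 1F = inj₂ (inj₁ refl)
  sameOrAdjacent 0F 2F = inj₂ (inj₂ refl)
  sameOrAdjacent 1F 0F = inj₂ (inj₂ refl)
  sameOrAdjacent 1F 1F = inj₁ refl
  sameOrAdjacent 1F 2F = inj₂ (inj₁ refl)
  sameOrAdjacent 2F 0F = inj₂ (inj₁ refl)
  sameOrAdjacent 2F 1F = inj₂ (inj₂ refl)
  sameOrAdjacent 2F 2F = inj₁ refl

  decode : ∀ {a} → a < 3 * m → ∃[ x ] ∃[ i ] (x < m × a ≡ point x i)
  decode {a} a<3m = a % m , fromℕ< (m<n*o⇒m/o<n a<3m) , m%n<n a m ,
    trans (m≡m%n+[m/n]*n a m) (cong (λ q → a % m + q * m) (sym (toℕ-fromℕ< (m<n*o⇒m/o<n a<3m))))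

  vertical : ℕ → Triple
  vertical x = point x 0F , point x 1F , point x 2F

  ∈-vertical : ∀ {x} i → point x i ∈ₜ vertical x
  ∈-vertical 0F = inj₁ refl
  ∈-vertical 1F = inj₂ (inj₁ refl)
  ∈-vertical 2F = inj₂ (inj₂ refl)

[x+u%m]%m≡[x+u]%m : ∀ x u m .{{_ : NonZero m}} → (x + u % m) % m ≡ (x + u) % m
[x+u%m]%m≡[x+u]%m x u m = begin
  (x + u % m) % m           ≡⟨ %-distribˡ-+ x (u % m) m ⟩
  (x % m + u % m % m) % m   ≡⟨ cong (λ r → (x % m + r) % m) (m%n%n≡m%n u m) ⟩
  (x % m + u % m) % m       ≡⟨ %-distribˡ-+ x u m ⟨
  (x + u) % m               ∎
  where open ≡-Reasoning

-- The lines {(x, i), (y, i), (x ⊙ y, i + 1)}, x < y, cover every pair of points within a level and, since ⊙ is a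
-- quasigroup, every pair {(x, i), (z, i + 1)} except those with z = x ⊙ x; the extra blocks E must cover these.
module QuasigroupDesign (m : ℕ) .{{_ : NonZero m}} (half : ℕ → ℕ)
                        (half-onto : ∀ {z} → z < m → ∃[ s ] (s < m × half s ≡ z)) where

  open Levels m public

  _⊙_ : ℕ → ℕ → ℕ
  x ⊙ y = half ((x + y) % m)

  ⊙-comm : ∀ x y → x ⊙ y ≡ y ⊙ x
  ⊙-comm x y = cong (λ s → half (s % m)) (+-comm x y)

  ⊙-solvable : ∀ {x z} → x < m → z < m → ∃[ y ] (y < m × x ⊙ y ≡ z)
  ⊙-solvable {x} {z} x<m z<m with half-onto z<m
  ... | s , s<m , half-s≡z = t % m , m%n<n t m , (begin
    half ((x + t % m) % m) ≡⟨ cong half ([x+u%m]%m≡[x+u]%m x t m) ⟩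
    half ((x + t) % m)     ≡⟨ cong (λ r → half (r % m)) x+t≡s+m ⟩
    half ((s + m) % m)     ≡⟨ cong half (trans ([m+n]%n≡m%n s m) (m<n⇒m%n≡m s<m)) ⟩
    half s                 ≡⟨ half-s≡z ⟩
    z                      ∎)
    where
    open ≡-Reasoning
    t : ℕ
    t = s + (m ∸ x)
    x+t≡s+m : x + t ≡ s + m
    x+t≡s+m = trans (x∙yz≈y∙xz x s (m ∸ x)) (cong (s +_) (m+[n∸m]≡n (<⇒≤ x<m)))

  line : Fin 3 → ℕ × ℕ → Triple
  line i (x , y) = point x i , point y i , point (x ⊙ y) (next i)

  linesAt : Fin 3 → List Triple
  linesAt i = map (line i) (pairsBelow m)

  lines : List Triple
  lines = onEachLevel linesAt

  length-lines : length lines ≡ 3 * length (pairsBelow m)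
  length-lines = length-onEachLevel linesAt _ (λ i → length-map (line i) (pairsBelow m))

  ∈-lines : ∀ {x y} i → x < y → y < m → line i (x , y) ∈ₗ lines
  ∈-lines i x<y y<m = ∈-onEachLevel linesAt i (∈-map⁺ (line i) (∈-pairsBelow x<y y<m))

  sameLevel : ∀ {x y} i → x < m → y < m → x ≢ y → PairCovered lines (point x i) (point y i)
  sameLevel {x} {y} i x<m y<m x≢y with <-cmp x y
  ... | tri< x<y _ _ = line i (x , y) , ∈-lines i x<y y<m , inj₁ refl , inj₂ (inj₁ refl)
  ... | tri≈ _ x≡y _ = contradiction x≡y x≢y
  ... | tri> _ _ y<x = line i (y , x) , ∈-lines i y<x x<m , inj₂ (inj₁ refl) , inj₁ refl

  nextLevel : ∀ {x y} i → x < m → y < m → x ≢ y → PairCovered lines (point x i) (point (x ⊙ y) (next i))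
  nextLevel {x} {y} i x<m y<m x≢y with <-cmp x y
  ... | tri< x<y _ _ = line i (x , y) , ∈-lines i x<y y<m , inj₁ refl , inj₂ (inj₂ refl)
  ... | tri≈ _ x≡y _ = contradiction x≡y x≢y
  ... | tri> _ _ y<x = line i (y , x) , ∈-lines i y<x x<m , inj₂ (inj₁ refl) ,
                       inj₂ (inj₂ (cong (λ z → point z (next i)) (⊙-comm x y)))

  module _ (E : List Triple) (diagonal : ∀ {x} i → x < m → PairCovered E (point x i) (point (x ⊙ x) (next i))) where

    anyNextLevel : ∀ {x z} i → x < m → z < m → PairCovered (lines ++ E) (point x i) (point z (next i))
    anyNextLevel {x} i x<m z<m with ⊙-solvable x<m z<m
    ... | y , y<m , refl with y ≟ x
    ...   | yes refl = PairCovered-++ʳ lines (diagonal i x<m)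
    ...   | no  y≢x  = PairCovered-++ˡ (nextLevel i x<m y<m (y≢x ∘ sym))

    lines-covers : CoversPairs (3 * m) (lines ++ E)
    lines-covers a<3m b<3m a≢b with decode a<3m | decode b<3m
    ... | x , i , x<m , refl | y , j , y<m , refl with sameOrAdjacent i j
    ...   | inj₁ refl        = PairCovered-++ˡ (sameLevel i x<m y<m λ { refl → a≢b refl })
    ...   | inj₂ (inj₁ refl) = anyNextLevel i x<m y<m
    ...   | inj₂ (inj₂ refl) = PairCovered-swap (anyNextLevel j y<m x<m)

[a%m*c]%m≡[a*c]%m : ∀ a c m .{{_ : NonZero m}} → (a % m * c) % m ≡ (a * c) % m
[a%m*c]%m≡[a*c]%m a c m = begin
  (a % m * c) % m             ≡⟨ %-distribˡ-* (a % m) c m ⟩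
  (a % m % m * (c % m)) % m   ≡⟨ cong (λ r → (r * (c % m)) % m) (m%n%n≡m%n a m) ⟩
  (a % m * (c % m)) % m       ≡⟨ %-distribˡ-* a c m ⟨
  (a * c) % m                 ∎
  where open ≡-Reasoning

CoversPairs-suc : ∀ {v L} → CoversPairs v L → (∀ {b} → b < v → PairCovered L v b) → CoversPairs (suc v) L
CoversPairs-suc cov cov-v a<1+v b<1+v a≢b with m<1+n⇒m<n∨m≡n a<1+v | m<1+n⇒m<n∨m≡n b<1+v
... | inj₁ a<v  | inj₁ b<v  = cov a<v b<v a≢b
... | inj₁ a<v  | inj₂ refl = PairCovered-swap (cov-v a<v)
... | inj₂ refl | inj₁ b<v  = cov-v b<v
... | inj₂ refl | inj₂ refl = contradiction refl a≢b

-- Bose: ℤ_m × ℤ_3 for odd m, with the idempotent quasigroup x ⊙ y = (x + y)/2 mod m.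
module Bose (k : ℕ) where

  m : ℕ
  m = suc (k * 2)

  half : ℕ → ℕ
  half s = (s * suc k) % m

  half-double : ∀ {x} → x < m → half ((x + x) % m) ≡ x
  half-double {x} x<m = begin
    ((x + x) % m * suc k) % m ≡⟨ [a%m*c]%m≡[a*c]%m (x + x) (suc k) m ⟩
    ((x + x) * suc k) % m     ≡⟨ cong (_% m) (identity x k) ⟩
    (x + x * m) % m           ≡⟨ [m+kn]%n≡m%n x x m ⟩
    x % m                     ≡⟨ m<n⇒m%n≡m x<m ⟩
    x                         ∎
    where
    open ≡-Reasoning
    identity : ∀ x k → (x + x) * suc k ≡ x + x * suc (k * 2)
    identity = solve-∀

  half-onto : ∀ {z} → z < m → ∃[ s ] (s < m × half s ≡ z)
  half-onto {z} z<m = (z + z) % m , m%n<n (z + z) m , half-double z<m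

  open QuasigroupDesign m half half-onto

  verticals : List Triple
  verticals = map vertical (upTo m)

  diagonal : ∀ {x} i → x < m → PairCovered verticals (point x i) (point (x ⊙ x) (next i))
  diagonal {x} i x<m = subst (λ z → PairCovered verticals (point x i) (point z (next i))) (sym (half-double x<m))
    (vertical x , ∈-map⁺ vertical (∈-upTo⁺ x<m) , ∈-vertical i , ∈-vertical (next i))

  system : SteinerTripleSystem (3 * m)
  system = record
    { blocks = lines ++ verticals
    ; covers = lines-covers verticals diagonal
    ; size   = begin
      6 * length (lines ++ verticals) + 3 * m  ≡⟨ cong (λ l → 6 * l + 3 * m) length-blocks ⟩
      6 * (3 * P + m) + 3 * m                  ≡⟨ identity₁ P m ⟩
      9 * (2 * P + m)                          ≡⟨ cong (9 *_) (length-pairsBelow m) ⟩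
      9 * (m * m)                              ≡⟨ identity₂ m ⟩
      3 * m * (3 * m)                          ∎
    }
    where
    open ≡-Reasoning
    P : ℕ
    P = length (pairsBelow m)
    length-blocks : length (lines ++ verticals) ≡ 3 * P + m
    length-blocks = trans (length-++ lines) (cong₂ _+_ length-lines (trans (length-map vertical (upTo m)) (length-upTo m)))
    identity₁ : ∀ P m → 6 * (3 * P + m) + 3 * m ≡ 9 * (2 * P + m)
    identity₁ = solve-∀
    identity₂ : ∀ m → 9 * (m * m) ≡ 3 * m * (3 * m)
    identity₂ = solve-∀

-- Skolem: ℤ_m × ℤ_3 ∪ {∞} for m = 2k, with the half-idempotent quasigroup
-- x ⊙ y = s/2 if s = x + y mod m is even, (s − 1)/2 + k if it is odd.
module Skolem (k₀ : ℕ) where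

  k m : ℕ
  k = suc k₀
  m = k * 2

  k*2≡k+k : k * 2 ≡ k + k
  k*2≡k+k = trans (*-comm k 2) (cong (k +_) (+-identityʳ k))

  half : ℕ → ℕ
  half s = ⌊ s /2⌋ + s % 2 * k

  half-even : ∀ d → half (d * 2) ≡ d
  half-even d rewrite ⌊k*2/2⌋≡k d | [k*2]%2≡0 d = +-identityʳ d

  half-odd : ∀ d → half (suc (d * 2)) ≡ d + k
  half-odd d rewrite ⌊1+d*2/2⌋≡d d | [1+k*2]%2≡1 d = cong (d +_) (+-identityʳ k)

  upperHalf : ∀ {x} → x < m → ¬ x < k → x ∸ k < k × x ∸ k + k ≡ x
  upperHalf {x} x<m x≮k = m<n+o⇒m∸n<o x k (subst (x <_) k*2≡k+k x<m) , m∸n+n≡m (≮⇒≥ x≮k)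

  half-onto : ∀ {z} → z < m → ∃[ s ] (s < m × half s ≡ z)
  half-onto {z} z<m with z <? k
  ... | yes z<k = z * 2 , *-monoˡ-< 2 z<k , half-even z
  ... | no  z≮k with upperHalf z<m z≮k
  ...   | d<k , d+k≡z = suc ((z ∸ k) * 2) , *-monoˡ-≤ 2 d<k , trans (half-odd (z ∸ k)) d+k≡z

  open QuasigroupDesign m half half-onto

  ⊙-lower : ∀ {x} → x < k → x ⊙ x ≡ x
  ⊙-lower {x} x<k = begin
    half ((x + x) % m)  ≡⟨ cong half (m<n⇒m%n≡m x+x<m) ⟩
    half (x + x)        ≡⟨ cong half (trans (*-comm x 2) (cong (x +_) (+-identityʳ x))) ⟨
    half (x * 2)        ≡⟨ half-even x ⟩
    x                   ∎
    where
    open ≡-Reasoning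
    x+x<m : x + x < m
    x+x<m = subst (x + x <_) (sym k*2≡k+k) (+-mono-< x<k x<k)

  ⊙-upper : ∀ {d} → d < k → (d + k) ⊙ (d + k) ≡ d
  ⊙-upper {d} d<k = begin
    half ((d + k + (d + k)) % m) ≡⟨ cong (λ s → half (s % m)) (identity d k) ⟩
    half ((d * 2 + m) % m)       ≡⟨ cong half (trans ([m+n]%n≡m%n (d * 2) m) (m<n⇒m%n≡m (*-monoˡ-< 2 d<k))) ⟩
    half (d * 2)                 ≡⟨ half-even d ⟩
    d                            ∎
    where
    open ≡-Reasoning
    identity : ∀ d k → d + k + (d + k) ≡ d * 2 + k * 2
    identity = solve-∀

  ∞ : ℕ
  ∞ = 3 * m

  verticals : List Triple
  verticals = map vertical (upTo k)

  ∞-block : Fin 3 → ℕ → Triple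
  ∞-block i d = ∞ , point (d + k) i , point d (next i)

  ∞-blocksAt : Fin 3 → List Triple
  ∞-blocksAt i = map (∞-block i) (upTo k)

  ∞-blocks : List Triple
  ∞-blocks = onEachLevel ∞-blocksAt

  ∈-∞-blocks : ∀ {d} i → d < k → ∞-block i d ∈ₗ ∞-blocks
  ∈-∞-blocks i d<k = ∈-onEachLevel ∞-blocksAt i (∈-map⁺ (∞-block i) (∈-upTo⁺ d<k))

  extraBlocks : List Triple
  extraBlocks = verticals ++ ∞-blocks

  diagonal : ∀ {x} i → x < m → PairCovered extraBlocks (point x i) (point (x ⊙ x) (next i))
  diagonal {x} i x<m with x <? k
  ... | yes x<k = subst (λ z → PairCovered extraBlocks (point x i) (point z (next i))) (sym (⊙-lower x<k))
    (PairCovered-++ˡ (vertical x , ∈-map⁺ vertical (∈-upTo⁺ x<k) , ∈-vertical i , ∈-vertical (next i)))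
  ... | no  x≮k with upperHalf x<m x≮k
  ...   | d<k , d+k≡x = subst (λ y → PairCovered extraBlocks (point y i) (point (y ⊙ y) (next i))) d+k≡x
    (PairCovered-++ʳ verticals (∞-block i (x ∸ k) , ∈-∞-blocks i d<k , inj₂ (inj₁ refl) ,
                      inj₂ (inj₂ (cong (λ z → point z (next i)) (⊙-upper d<k)))))

  ∞-covered : ∀ {b} → b < ∞ → PairCovered extraBlocks ∞ b
  ∞-covered b<∞ with decode b<∞
  ... | z , j , z<m , refl with z <? k
  ...   | yes z<k = PairCovered-++ʳ verticals (∞-block (prev j) z , ∈-∞-blocks (prev j) z<k , inj₁ refl ,
                                     inj₂ (inj₂ (cong (point z) (sym (next-prev j)))))
  ...   | no  z≮k with upperHalf z<m z≮k
  ...     | d<k , d+k≡z = PairCovered-++ʳ verticals (∞-block j (z ∸ k) , ∈-∞-blocks j d<k , inj₁ refl ,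
                                           inj₂ (inj₁ (cong (λ y → point y j) (sym d+k≡z))))

  system : SteinerTripleSystem (suc ∞)
  system = record
    { blocks = lines ++ extraBlocks
    ; covers = CoversPairs-suc (lines-covers extraBlocks diagonal) (PairCovered-++ʳ lines ∘ ∞-covered)
    ; size   = begin
      6 * length (lines ++ extraBlocks) + suc ∞      ≡⟨ cong (λ l → 6 * l + suc ∞) length-blocks ⟩
      6 * (3 * P + (k + 3 * k)) + suc (3 * (k * 2)) ≡⟨ identity₁ P k ⟩
      9 * (2 * P + m) + 12 * k + 1                  ≡⟨ cong (λ q → 9 * q + 12 * k + 1) (length-pairsBelow m) ⟩
      9 * (m * m) + 12 * k + 1                      ≡⟨ identity₂ k ⟩
      suc ∞ * suc ∞                                 ∎
    }
    where
    open ≡-Reasoning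
    P : ℕ
    P = length (pairsBelow m)
    length-blocks : length (lines ++ extraBlocks) ≡ 3 * P + (k + 3 * k)
    length-blocks = trans (length-++ lines) (cong₂ _+_ length-lines (trans (length-++ verticals)
      (cong₂ _+_ (trans (length-map vertical (upTo k)) (length-upTo k))
                 (length-onEachLevel ∞-blocksAt k (λ i → trans (length-map (∞-block i) (upTo k)) (length-upTo k))))))
    identity₁ : ∀ P k → 6 * (3 * P + (k + 3 * k)) + suc (3 * (k * 2)) ≡ 9 * (2 * P + k * 2) + 12 * k + 1
    identity₁ = solve-∀
    identity₂ : ∀ k → 9 * (k * 2 * (k * 2)) + 12 * k + 1 ≡ suc (3 * (k * 2)) * suc (3 * (k * 2))
    identity₂ = solve-∀

steiner-6k+3 : ∀ k → SteinerTripleSystem (6 * k + 3)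
steiner-6k+3 k = subst SteinerTripleSystem (identity k) (Bose.system k)
  where
  identity : ∀ k → 3 * suc (k * 2) ≡ 6 * k + 3
  identity = solve-∀

steiner-6k+7 : ∀ k → SteinerTripleSystem (6 * k + 7)
steiner-6k+7 k = subst SteinerTripleSystem (identity k) (Skolem.system k)
  where
  identity : ∀ k → suc (3 * (suc k * 2)) ≡ 6 * k + 7
  identity = solve-∀

-- Dominating sets from pair covers

⁅_⁆ᴺ : ℕ → Subset n
⁅_⁆ᴺ {n} a with a <? n
... | yes a<n = ⁅ fromℕ< a<n ⁆
... | no  _   = ⊥

∣⁅a⁆ᴺ∣≤1 : ∀ a → ∣ ⁅_⁆ᴺ {n} a ∣ ≤ 1
∣⁅a⁆ᴺ∣≤1 {n} a with a <? n
... | yes a<n = ≤-reflexive (∣⁅x⁆∣≡1 (fromℕ< a<n))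
... | no  _   = ≤-trans (≤-reflexive (∣⊥∣≡0 n)) z≤n

x∈⁅a⁆ᴺ : ∀ {a} → a ≡ toℕ x → x ∈ ⁅ a ⁆ᴺ
x∈⁅a⁆ᴺ {n} {x} refl with toℕ x <? n
... | yes x<n = subst (_∈ ⁅ fromℕ< x<n ⁆) (fromℕ<-toℕ x x<n) (x∈⁅x⁆ (fromℕ< x<n))
... | no  x≮n = contradiction (toℕ<n x) x≮n

placedAt : ℕ → Triple → Subset n
placedAt s (p , q , r) = ⁅ s + p ⁆ᴺ ∪ ⁅ s + q ⁆ᴺ ∪ ⁅ s + r ⁆ᴺ

∣p∪q∪r∣≤3 : ∀ (p q r : Subset n) → ∣ p ∣ ≤ 1 → ∣ q ∣ ≤ 1 → ∣ r ∣ ≤ 1 → ∣ p ∪ q ∪ r ∣ ≤ 3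
∣p∪q∪r∣≤3 p q r ∣p∣≤1 ∣q∣≤1 ∣r∣≤1 = ≤-trans (∣p∪q∣≤∣p∣+∣q∣ p (q ∪ r))
  (+-mono-≤ ∣p∣≤1 (≤-trans (∣p∪q∣≤∣p∣+∣q∣ q r) (+-mono-≤ ∣q∣≤1 ∣r∣≤1)))

∣placedAt∣≤3 : ∀ s t → ∣ placedAt {n} s t ∣ ≤ 3
∣placedAt∣≤3 {n} s (p , q , r) =
  ∣p∪q∪r∣≤3 (⁅_⁆ᴺ {n} (s + p)) ⁅ s + q ⁆ᴺ ⁅ s + r ⁆ᴺ
            (∣⁅a⁆ᴺ∣≤1 {n} (s + p)) (∣⁅a⁆ᴺ∣≤1 {n} (s + q)) (∣⁅a⁆ᴺ∣≤1 {n} (s + r))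

∈-placedAt : ∀ {s a} t → s + a ≡ toℕ x → a ∈ₜ t → x ∈ placedAt s t
∈-placedAt (p , q , r) s+a≡x (inj₁ refl)        = x∈p∪q⁺ (inj₁ (x∈⁅a⁆ᴺ s+a≡x))
∈-placedAt (p , q , r) s+a≡x (inj₂ (inj₁ refl)) = x∈p∪q⁺ (inj₂ (x∈p∪q⁺ (inj₁ (x∈⁅a⁆ᴺ s+a≡x))))
∈-placedAt (p , q , r) s+a≡x (inj₂ (inj₂ refl)) = x∈p∪q⁺ (inj₂ (x∈p∪q⁺ (inj₂ (x∈⁅a⁆ᴺ s+a≡x))))

extendTo : ℕ → Subset n → Subset n
extendTo k []            = []
extendTo k (inside  ∷ p) = inside ∷ extendTo (pred k) p
extendTo k (outside ∷ p) with ∣ p ∣ <? k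
... | yes _ = inside  ∷ extendTo (pred k) p
... | no  _ = outside ∷ extendTo k p

⊆-extendTo : ∀ k (p : Subset n) → p ⊆ extendTo k p
⊆-extendTo k (inside  ∷ p) here        = here
⊆-extendTo k (inside  ∷ p) (there x∈p) = there (⊆-extendTo (pred k) p x∈p)
⊆-extendTo k (outside ∷ p) (there x∈p) with ∣ p ∣ <? k
... | yes _ = there (⊆-extendTo (pred k) p x∈p)
... | no  _ = there (⊆-extendTo k p x∈p)

∣extendTo∣ : ∀ k (p : Subset n) → ∣ p ∣ ≤ k → k ≤ n → ∣ extendTo k p ∣ ≡ k
∣extendTo∣ zero    []            _           _         = refl
∣extendTo∣ (suc k) (inside  ∷ p) (s≤s ∣p∣≤k) (s≤s k≤n) = cong suc (∣extendTo∣ k p ∣p∣≤k k≤n)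
∣extendTo∣ k       (outside ∷ p) ∣p∣≤k       k≤1+n     with ∣ p ∣ <? k
... | yes (s≤s ∣p∣≤k-1) = cong suc (∣extendTo∣ _ p ∣p∣≤k-1 (s≤s⁻¹ k≤1+n))
... | no  ∣p∣≮k         = ∣extendTo∣ k p ∣p∣≤k (subst (_≤ _) (≤-antisym ∣p∣≤k (≮⇒≥ ∣p∣≮k)) (∣p∣≤n p))

_≟ₛ_ : DecidableEquality (Subset n)
_≟ₛ_ = ≡-dec Bool._≟_

length-deduplicate≤ : ∀ {A : Set} (_≟_ : DecidableEquality A) xs → length (deduplicate _≟_ xs) ≤ length xs
length-deduplicate≤ _≟_ []       = z≤n
length-deduplicate≤ _≟_ (x ∷ xs) = s≤s (≤-trans (length-filter _ (deduplicate _≟_ xs)) (length-deduplicate≤ _≟_ xs))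

twoOfThree : ∀ (a b c : Bool) → a ≡ b ⊎ a ≡ c ⊎ b ≡ c
twoOfThree false false _     = inj₁ refl
twoOfThree true  true  _     = inj₁ refl
twoOfThree false true  false = inj₂ (inj₁ refl)
twoOfThree true  false true  = inj₂ (inj₁ refl)
twoOfThree false true  true  = inj₂ (inj₂ refl)
twoOfThree true  false false = inj₂ (inj₂ refl)

monochromaticPair : (colour : Fin n → Bool) → ∣ B ∣ ≡ 3 → ∃[ u ] ∃[ v ] (u ≢ v × colour u ≡ colour v × u ∈ B × v ∈ B)
monochromaticPair {B = B} colour ∣B∣≡3 = pick (∣p∣≡3⇒triple {B = B} ∣B∣≡3)
  where
  pick : ∃[ x ] ∃[ y ] ∃[ z ] (x ≢ y × x ≢ z × y ≢ z × B ≡ triple x y z) →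
         ∃[ u ] ∃[ v ] (u ≢ v × colour u ≡ colour v × u ∈ B × v ∈ B)
  pick (x , y , z , x≢y , x≢z , y≢z , B≡xyz) = choose (twoOfThree (colour x) (colour y) (colour z))
    where
    ∈B : w ∈ triple x y z → w ∈ B
    ∈B = subst (_ ∈_) (sym B≡xyz)
    choose : colour x ≡ colour y ⊎ colour x ≡ colour z ⊎ colour y ≡ colour z →
             ∃[ u ] ∃[ v ] (u ≢ v × colour u ≡ colour v × u ∈ B × v ∈ B)
    choose (inj₁ same)        = x , y , x≢y , same , ∈B x∈triple , ∈B y∈triple
    choose (inj₂ (inj₁ same)) = x , z , x≢z , same , ∈B x∈triple , ∈B z∈triple
    choose (inj₂ (inj₂ same)) = y , z , y≢z , same , ∈B y∈triple , ∈B z∈triple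

dominatingSet-fromCover : 3 ≤ n → (colour : Fin n → Bool) (C : List (Subset n)) → All (λ A → ∣ A ∣ ≤ 3) C →
                          (∀ {u v} → u ≢ v → colour u ≡ colour v → ∃[ A ] (A ∈ₗ C × u ∈ A × v ∈ A)) →
                          ∃[ D ] (IsDominatingSet (K n) 3 D × length D ≤ length C)
dominatingSet-fromCover {n} 3≤n colour C C≤3 covered = D , (deduplicate-! _≟ₛ_ D₀ , tokens , dominating) , length≤
  where
  D₀ D : List (Subset n)
  D₀ = map (extendTo 3) C
  D  = deduplicate _≟ₛ_ D₀
  tokens : All (IsToken 3) D
  tokens = All.deduplicate⁺ _≟ₛ_ (All.map⁺ (All.map (λ {A} ∣A∣≤3 → ∣extendTo∣ 3 A ∣A∣≤3 3≤n) C≤3))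
  length≤ : length D ≤ length C
  length≤ = ≤-trans (length-deduplicate≤ _≟ₛ_ D₀) (≤-reflexive (length-map _ C))
  dominatedVia : (∃[ u ] ∃[ v ] (u ≢ v × colour u ≡ colour v × u ∈ B × v ∈ B)) → IsToken 3 B →
                 ∃[ A ] (A ∈ₗ D × Dominates A B)
  dominatedVia {B = B} (u , v , u≢v , same , u∈B , v∈B) ∣B∣≡3 with covered u≢v same
  ... | A , A∈C , u∈A , v∈A = extendTo 3 A , ∈-deduplicate⁺ _≟ₛ_ (∈-map⁺ (extendTo 3) A∈C) ,
    sharedPair⇒Dominates {A = extendTo 3 A} {B = B} (∣extendTo∣ 3 A (All.lookup C≤3 A∈C) 3≤n) ∣B∣≡3 u≢v
                         (⊆-extendTo 3 A u∈A) (⊆-extendTo 3 A v∈A) u∈B v∈B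
  dominating : Dominating D
  dominating B ∣B∣≡3 = dominatedVia (monochromaticPair {B = B} colour ∣B∣≡3) ∣B∣≡3

window-covered : ∀ {s v L} → CoversPairs v L → u ≢ w → s ≤ toℕ u → s ≤ toℕ w → toℕ u < s + v → toℕ w < s + v →
                 ∃[ A ] (A ∈ₗ map (placedAt s) L × u ∈ A × w ∈ A)
window-covered {u = u} {w = w} {s = s} {v = v} cover u≢w s≤u s≤w u<s+v w<s+v
  with cover (offset< s≤u u<s+v) (offset< s≤w w<s+v) (λ eq → u≢w (toℕ-injective (offset-injective s≤u s≤w eq)))
  where
  offset< : ∀ {x} → s ≤ x → x < s + v → x ∸ s < v
  offset< s≤x x<s+v = subst (_ <_) (m+n∸m≡n s v) (∸-monoˡ-< x<s+v s≤x)
  offset-injective : ∀ {x y} → s ≤ x → s ≤ y → x ∸ s ≡ y ∸ s → x ≡ y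
  offset-injective s≤x s≤y eq = trans (sym (m+[n∸m]≡n s≤x)) (trans (cong (s +_) eq) (m+[n∸m]≡n s≤y))
... | t , t∈L , a∈t , b∈t =
  placedAt s t , ∈-map⁺ (placedAt s) t∈L , ∈-placedAt t (m+[n∸m]≡n s≤u) a∈t , ∈-placedAt t (m+[n∸m]≡n s≤w) b∈t

dominatingSet-fromHalves : ∀ {h₁ h₂ v₁ v₂ L₁ L₂} → 3 ≤ n → h₁ + h₂ ≡ n →
                           h₁ ≤ v₁ → CoversPairs v₁ L₁ → h₂ ≤ v₂ → CoversPairs v₂ L₂ →
                           ∃[ D ] (IsDominatingSet (K n) 3 D × length D ≤ length L₁ + length L₂)
dominatingSet-fromHalves {n} {h₁} {h₂} {v₁} {v₂} {L₁} {L₂} 3≤n h₁+h₂≡n h₁≤v₁ cover₁ h₂≤v₂ cover₂ =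
  Product.map₂ (Product.map₂ (λ ∣D∣≤∣C∣ → ≤-trans ∣D∣≤∣C∣ (≤-reflexive length-C)))
    (dominatingSet-fromCover 3≤n colour C C≤3 covered)
  where
  colour : Fin n → Bool
  colour u = does (toℕ u <? h₁)
  C : List (Subset n)
  C = map (placedAt 0) L₁ ++ map (placedAt h₁) L₂
  length-C : length C ≡ length L₁ + length L₂
  length-C = trans (length-++ (map (placedAt 0) L₁)) (cong₂ _+_ (length-map _ L₁) (length-map _ L₂))
  C≤3 : All (λ A → ∣ A ∣ ≤ 3) C
  C≤3 = All.++⁺ (All.map⁺ (All.universal (∣placedAt∣≤3 {n} 0) L₁))
                (All.map⁺ (All.universal (∣placedAt∣≤3 {n} h₁) L₂))
  inWindow₂ : ∀ {x} → x < n → x < h₁ + v₂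
  inWindow₂ x<n = <-≤-trans (subst (_ <_) (sym h₁+h₂≡n) x<n) (+-monoʳ-≤ h₁ h₂≤v₂)
  covered : ∀ {u w} → u ≢ w → colour u ≡ colour w → ∃[ A ] (A ∈ₗ C × u ∈ A × w ∈ A)
  covered {u} {w} u≢w = sameHalf (toℕ u <? h₁) (toℕ w <? h₁)
    where
    sameHalf : (u<? : Dec (toℕ u < h₁)) (w<? : Dec (toℕ w < h₁)) → does u<? ≡ does w<? →
               ∃[ A ] (A ∈ₗ C × u ∈ A × w ∈ A)
    sameHalf (yes u<h₁) (yes w<h₁) _ = Product.map₂ (Product.map₁ ∈-++⁺ˡ)
      (window-covered cover₁ u≢w z≤n z≤n (≤-trans u<h₁ h₁≤v₁) (≤-trans w<h₁ h₁≤v₁))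
    sameHalf (no  u≮h₁) (no  w≮h₁) _ = Product.map₂ (Product.map₁ (∈-++⁺ʳ _))
      (window-covered cover₂ u≢w (≮⇒≥ u≮h₁) (≮⇒≥ w≮h₁) (inWindow₂ (toℕ<n u)) (inWindow₂ (toℕ<n w)))

-- Upper bounds

steinerHalf : ∀ n → n ≥ 4 → n % 12 ≡ 2 ⊎ n % 12 ≡ 6 → ∃[ v ] (n ≡ v + v × SteinerTripleSystem v)
steinerHalf n n≥4 (inj₁ n%12≡2) with n / 12 | m≡m%n+[m/n]*n n 12
... | zero  | n≡ rewrite n%12≡2 = contradiction (subst (4 ≤_) n≡ n≥4) λ { (s≤s (s≤s ())) }
... | suc q | n≡ rewrite n%12≡2 = 6 * q + 7 , trans n≡ (identity q) , steiner-6k+7 q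
  where
  identity : ∀ q → 2 + suc q * 12 ≡ 6 * q + 7 + (6 * q + 7)
  identity = solve-∀
steinerHalf n n≥4 (inj₂ n%12≡6) with n / 12 | m≡m%n+[m/n]*n n 12
... | q | n≡ rewrite n%12≡6 = 6 * q + 3 , trans n≡ (identity q) , steiner-6k+3 q
  where
  identity : ∀ q → 6 + q * 12 ≡ 6 * q + 3 + (6 * q + 3)
  identity = solve-∀

dominationNumber-fromMatchingBound : ∀ {n} → n ≥ 4 → n % 2 ≡ 0 → ∀ D → IsDominatingSet (K n) 3 D →
                                     12 * length D ≤ n * n ∸ 2 * n →
                                     IsDominationNumber (K n) 3 (length D) × 12 * length D ≡ n * n ∸ 2 * n
dominationNumber-fromMatchingBound {n} n≥4 n-even D D-dom 12∣D∣≤ =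
  ((D , D-dom , refl) , minimal) , ≤-antisym 12∣D∣≤ (lower D D-dom)
  where
  lower : ∀ D′ → IsDominatingSet (K n) 3 D′ → n * n ∸ 2 * n ≤ 12 * length D′
  lower D′ D′-dom = proj₁ (lowerBound n n≥4 D′ D′-dom) n-even
  minimal : ∀ D′ → IsDominatingSet (K n) 3 D′ → length D ≤ length D′
  minimal D′ D′-dom = *-cancelˡ-≤ 12 (≤-trans 12∣D∣≤ (lower D′ D′-dom))

dominationNumber-double : ∀ {v} → v + v ≥ 4 → SteinerTripleSystem v →
                          ∃[ g ] (IsDominationNumber (K (v + v)) 3 g × 12 * g ≡ (v + v) * (v + v) ∸ 2 * (v + v))
dominationNumber-double {v} n≥4 S = exact (dominatingSet-fromHalves (≤-trans (n≤1+n 3) n≥4) refl ≤-refl covers ≤-refl covers)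
  where
  open SteinerTripleSystem S
  l : ℕ
  l = length blocks
  n-even : (v + v) % 2 ≡ 0
  n-even = trans (cong (_% 2) (identity v)) ([k*2]%2≡0 v)
    where
    identity : ∀ v → v + v ≡ v * 2
    identity = solve-∀
  n²≡12*2l+2n : (v + v) * (v + v) ≡ 12 * (l + l) + 2 * (v + v)
  n²≡12*2l+2n = begin
    (v + v) * (v + v)          ≡⟨ identity₁ v ⟩
    4 * (v * v)                ≡⟨ cong (4 *_) size ⟨
    4 * (6 * l + v)            ≡⟨ identity₂ l v ⟩
    12 * (l + l) + 2 * (v + v) ∎
    where
    open ≡-Reasoning
    identity₁ : ∀ v → (v + v) * (v + v) ≡ 4 * (v * v)
    identity₁ = solve-∀
    identity₂ : ∀ l v → 4 * (6 * l + v) ≡ 12 * (l + l) + 2 * (v + v)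
    identity₂ = solve-∀
  exact : ∃[ D ] (IsDominatingSet (K (v + v)) 3 D × length D ≤ l + l) →
          ∃[ g ] (IsDominationNumber (K (v + v)) 3 g × 12 * g ≡ (v + v) * (v + v) ∸ 2 * (v + v))
  exact (D , D-dom , ∣D∣≤2l) = length D , dominationNumber-fromMatchingBound n≥4 n-even D D-dom
    (≤-trans (*-monoʳ-≤ 12 ∣D∣≤2l) (≤-reflexive (sym (trans (cong (_∸ 2 * (v + v)) n²≡12*2l+2n) (m+n∸n≡m _ (2 * (v + v)))))))

exactDominationNumber : ∀ n → n ≥ 4 → n % 12 ≡ 2 ⊎ n % 12 ≡ 6 → ∃[ g ] (IsDominationNumber (K n) 3 g × 12 * g ≡ n * n ∸ 2 * n)
exactDominationNumber n n≥4 n%12 with steinerHalf n n≥4 n%12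
... | v , refl , S = dominationNumber-double n≥4 S

steinerAbove : ∀ h → ∃[ v ] (h ≤ v × v ≤ h + 9 × SteinerTripleSystem v)
steinerAbove h = 6 * suc k + 3 , h≤v , v≤h+9 , steiner-6k+3 (suc k)
  where
  open ≤-Reasoning
  k j : ℕ
  k = h / 6
  j = h % 6
  h≡j+k*6 : h ≡ j + k * 6
  h≡j+k*6 = m≡m%n+[m/n]*n h 6
  identity : ∀ k → 6 * suc k + 3 ≡ 9 + k * 6
  identity = solve-∀
  h≤v : h ≤ 6 * suc k + 3
  h≤v = begin
    h              ≡⟨ h≡j+k*6 ⟩
    j + k * 6      ≤⟨ +-monoˡ-≤ (k * 6) (≤-trans (<⇒≤ (m%n<n h 6)) (m≤m+n 6 3)) ⟩
    9 + k * 6      ≡⟨ identity k ⟨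
    6 * suc k + 3  ∎
  v≤h+9 : 6 * suc k + 3 ≤ h + 9
  v≤h+9 = begin
    6 * suc k + 3  ≡⟨ trans (identity k) (+-comm 9 (k * 6)) ⟩
    k * 6 + 9      ≤⟨ +-monoˡ-≤ 9 (m≤n+m (k * 6) j) ⟩
    j + k * 6 + 9  ≡⟨ cong (_+ 9) h≡j+k*6 ⟨
    h + 9          ∎

balancedSplit : ∀ n → ∃[ h₁ ] ∃[ h₂ ] (h₁ + h₂ ≡ n × 2 * ((h₁ + 9) * (h₁ + 9)) + 2 * ((h₂ + 9) * (h₂ + 9)) ≤ n * n + 36 * n + 325)
balancedSplit n with parity n
... | even k = k , k , identity₁ k , ≤-trans (≤-reflexive (identity₂ k)) (+-monoʳ-≤ (k * 2 * (k * 2) + 36 * (k * 2)) (n≤1+n 324))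
  where
  identity₁ : ∀ k → k + k ≡ k * 2
  identity₁ = solve-∀
  identity₂ : ∀ k → 2 * ((k + 9) * (k + 9)) + 2 * ((k + 9) * (k + 9)) ≡ k * 2 * (k * 2) + 36 * (k * 2) + 324
  identity₂ = solve-∀
... | odd k = k , suc k , identity₁ k , ≤-reflexive (identity₂ k)
  where
  identity₁ : ∀ k → k + suc k ≡ suc (k * 2)
  identity₁ = solve-∀
  identity₂ : ∀ k → 2 * ((k + 9) * (k + 9)) + 2 * ((suc k + 9) * (suc k + 9)) ≡ suc (k * 2) * suc (k * 2) + 36 * suc (k * 2) + 325
  identity₂ = solve-∀

6*∣blocks∣≤v² : ∀ {v} (S : SteinerTripleSystem v) → 6 * length (SteinerTripleSystem.blocks S) ≤ v * v
6*∣blocks∣≤v² {v} S = ≤-trans (m≤m+n _ v) (≤-reflexive (SteinerTripleSystem.size S))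

nearlyOptimalDominatingSet : ∀ n → n ≥ 4 → ∃[ D ] (IsDominatingSet (K n) 3 D × 12 * length D ≤ n * n + 36 * n + 325)
nearlyOptimalDominatingSet n n≥4 =
  let (h₁ , h₂ , h₁+h₂≡n , squares≤) = balancedSplit n
      (v₁ , h₁≤v₁ , v₁≤h₁+9 , S₁) = steinerAbove h₁
      (v₂ , h₂≤v₂ , v₂≤h₂+9 , S₂) = steinerAbove h₂
      open SteinerTripleSystem
      (D , D-dom , ∣D∣≤l₁+l₂) =
        dominatingSet-fromHalves (≤-trans (n≤1+n 3) n≥4) h₁+h₂≡n h₁≤v₁ (covers S₁) h₂≤v₂ (covers S₂)
      l₁ = length (blocks S₁)
      l₂ = length (blocks S₂)
  in D , D-dom , (begin
    12 * length D                                          ≤⟨ *-monoʳ-≤ 12 ∣D∣≤l₁+l₂ ⟩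
    12 * (l₁ + l₂)                                         ≡⟨ identity l₁ l₂ ⟩
    2 * (6 * l₁) + 2 * (6 * l₂)
      ≤⟨ +-mono-≤ (*-monoʳ-≤ 2 (≤-trans (6*∣blocks∣≤v² S₁) (*-mono-≤ v₁≤h₁+9 v₁≤h₁+9)))
                  (*-monoʳ-≤ 2 (≤-trans (6*∣blocks∣≤v² S₂) (*-mono-≤ v₂≤h₂+9 v₂≤h₂+9))) ⟩
    2 * ((h₁ + 9) * (h₁ + 9)) + 2 * ((h₂ + 9) * (h₂ + 9))  ≤⟨ squares≤ ⟩
    n * n + 36 * n + 325                                   ∎)
  where
  open ≤-Reasoning
  identity : ∀ l₁ l₂ → 12 * (l₁ + l₂) ≡ 2 * (6 * l₁) + 2 * (6 * l₂)
  identity = solve-∀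

asymptotic-arith : ∀ M n → 1 ≤ M → 400 * M ≤ n → M * (n * n + 36 * n + 325) ≤ (M + 1) * (n * n ∸ 2 * n)
asymptotic-arith M n 1≤M 400M≤n = begin
  M * (n * n + 36 * n + 325)       ≡⟨ cong (λ s → M * (s + 36 * n + 325)) Y+2n≡n² ⟨
  M * (Y + 2 * n + 36 * n + 325)   ≡⟨ identity₁ M Y n ⟩
  M * Y + M * (38 * n + 325)       ≤⟨ +-monoʳ-≤ (M * Y) (+-cancelʳ-≤ (2 * n) _ _ M[38n+325]+2n≤Y+2n) ⟩
  M * Y + Y                        ≡⟨ identity₂ M Y ⟩
  (M + 1) * Y                      ∎
  where
  open ≤-Reasoning
  Y : ℕ
  Y = n * n ∸ 2 * n
  400≤n : 400 ≤ n
  400≤n = ≤-trans (*-monoʳ-≤ 400 1≤M) 400M≤n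
  1≤n : 1 ≤ n
  1≤n = ≤-trans (s≤s z≤n) 400≤n
  Y+2n≡n² : Y + 2 * n ≡ n * n
  Y+2n≡n² = m∸n+n≡m (*-monoˡ-≤ n (≤-trans (s≤s (s≤s z≤n)) 400≤n))
  identity₁ : ∀ M Y n → M * (Y + 2 * n + 36 * n + 325) ≡ M * Y + M * (38 * n + 325)
  identity₁ = solve-∀
  identity₂ : ∀ M Y → M * Y + Y ≡ (M + 1) * Y
  identity₂ = solve-∀
  slack : ∀ M n → 1 ≤ M → 1 ≤ n → M * (38 * n + 325) + 2 * n ≤ 400 * M * n
  slack (suc M) (suc n) _ _ = ≤-trans (m≤m+n _ (362 * M * n + 37 * M + 360 * n + 35)) (≤-reflexive (identity₃ M n))
    where
    identity₃ : ∀ M n → suc M * (38 * suc n + 325) + 2 * suc n + (362 * M * n + 37 * M + 360 * n + 35) ≡ 400 * suc M * suc n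
    identity₃ = solve-∀
  M[38n+325]+2n≤Y+2n : M * (38 * n + 325) + 2 * n ≤ Y + 2 * n
  M[38n+325]+2n≤Y+2n = begin
    M * (38 * n + 325) + 2 * n ≤⟨ slack M n 1≤M 1≤n ⟩
    400 * M * n                ≤⟨ *-monoˡ-≤ n 400M≤n ⟩
    n * n                      ≡⟨ Y+2n≡n² ⟨
    Y + 2 * n                  ∎

asymptoticUpperBound : (m : ℕ) → ∃[ N ] ((n : ℕ) → n ≥ 4 → n ≥ N →
               (n % 2 ≡ 0 → ∃[ D ] (IsDominatingSet (K n) 3 D × suc m * (12 * length D) ≤ (suc m + 1) * (n * n ∸ 2 * n))) ×
               (n % 2 ≡ 1 → ∃[ D ] (IsDominatingSet (K n) 3 D × suc m * (12 * length D) ≤ (suc m + 1) * (n * n ∸ 2 * n + 3))))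
asymptoticUpperBound m = 400 * suc m , λ n n≥4 n≥N →
  let (D , D-dom , 12∣D∣≤) = nearlyOptimalDominatingSet n n≥4
      bound = ≤-trans (*-monoʳ-≤ (suc m) 12∣D∣≤) (asymptotic-arith (suc m) n (s≤s z≤n) n≥N)
  in (λ _ → D , D-dom , bound) , (λ _ → D , D-dom , ≤-trans bound (*-monoʳ-≤ (suc m + 1) (m≤m+n _ 3)))

theorem4p2 :
  -- lower bounds (12·γ ≥ n²−2n for n even, 12·γ ≥ n²−2n+3 for n odd)
  ((n : ℕ) → n ≥ 4 → ∀ D → IsDominatingSet (K n) 3 D →
     (n % 2 ≡ 0 → n * n ∸ 2 * n ≤ 12 * length D) ×
     (n % 2 ≡ 1 → n * n ∸ 2 * n + 3 ≤ 12 * length D))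
  ×
  -- upper bounds γ ≤ (1 + o(1)) f(n): for every ε = 1/(m+1) there is N such that
  -- for n ≥ N some dominating set D has 12·|D| ≤ (1 + ε)(12 f(n))
  ((m : ℕ) → ∃[ N ] ((n : ℕ) → n ≥ 4 → n ≥ N →
     (n % 2 ≡ 0 → ∃[ D ] (IsDominatingSet (K n) 3 D ×
        suc m * (12 * length D) ≤ (suc m + 1) * (n * n ∸ 2 * n))) ×
     (n % 2 ≡ 1 → ∃[ D ] (IsDominatingSet (K n) 3 D ×
        suc m * (12 * length D) ≤ (suc m + 1) * (n * n ∸ 2 * n + 3)))))
  ×
  -- exact value for n ≡ 2, 6 (mod 12): 12·γ = n² − 2n
  ((n : ℕ) → n ≥ 4 → (n % 12 ≡ 2 ⊎ n % 12 ≡ 6) →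
     ∃[ g ] (IsDominationNumber (K n) 3 g × 12 * g ≡ n * n ∸ 2 * n))
theorem4p2 = lowerBound , asymptoticUpperBound , exactDominationNumber
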